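{- Let $D$ be the derivation of $\mathbb{Q}[x,y]$ determined by $D(x)=x+xy$ and $D(y)=y+x^2$. For $n\ge 0$ write $$D^n(x)=\sum_{i\ge 1,\,j\ge 0}b_{n,i,j}\,x^iy^j,$$ set $b_{n,i,j}=0$ for other index triples, and define $$B(x,p,q)=\sum_{n,i,j\ge 0}b_{n,i,j}\,p^iq^j\frac{x^n}{n!}$$ (with $x$ a new formal variable). Then $$B(x,p,q)=\frac{p\sqrt{q^2-p^2}\,e^x}{\sqrt{q^2-p^2}\cosh\!\big(\sqrt{q^2-p^2}(e^x-1)\big)-q\sinh\!\big(\sqrt{q^2-p^2}(e^x-1)\big)}.$$ Moreover, for all $n,i,j\ge 1$, $$b_{n,2i-1,j}=S(n+1,2i-1+j)\,P(2i-2+j,i-1).$$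
   Context: A derivation is a linear map satisfying $D(fg)=D(f)g+fD(g)$. $S(n,k)$ is the Stirling number of the second kind. For a list of distinct integers $w_1\cdots w_m$, with the convention $w_0=0$, a left peak is an entry $w_r$ with $r\in\{1,\dots,m-1\}$ such that $w_{r-1}<w_r>w_{r+1}$. $P(m,k)$ denotes the number of permutations of $\{1,\dots,m\}$ with exactly $k$ left peaks. -}

module Defs where

open import Data.Nat as ℕ using (ℕ; zero; suc; _∸_; _<ᵇ_; _≡ᵇ_)
open import Data.Nat.Properties using (_!≢0)
open import Data.Nat using (_!)
open import Data.Integer using (+_)
open import Data.Rational using (ℚ; 0ℚ; 1ℚ; _+_; _*_; _-_; -_; _/_)
open import Data.Bool using (Bool; true; false; _∧_; if_then_else_)
open import Data.List using (List; []; _∷_; _++_; map; concatMap; foldr; length; filter)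
open import Data.Product using (_×_; _,_)
open import Relation.Binary.PropositionalEquality using (_≡_)
open import Relation.Nullary.Decidable using (⌊_⌋)
open import Function using (_∘_)

ℕtoℚ : ℕ → ℚ
ℕtoℚ n = + n / 1

inv! : ℕ → ℚ
inv! n = + 1 / (n !)
  where instance _ = n !≢0

-- Polynomials in ℚ[x,y] as finite lists of terms  c · x^i y^j

Term : Set
Term = ℚ × ℕ × ℕ

Poly : Set
Poly = List Term

coeff : Poly → ℕ → ℕ → ℚ
coeff []                a b = 0ℚ
coeff ((c , i , j) ∷ f) a b =
  (if (i ≡ᵇ a) ∧ (j ≡ᵇ b) then c else 0ℚ) + coeff f a b

mulPoly : Poly → Poly → Poly
mulPoly f g =
  concatMap (λ { (c , i , j) → map (λ { (d , k , l) → (c * d , i ℕ.+ k , j ℕ.+ l) }) g }) f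

Dx : Poly
Dx = (1ℚ , 1 , 0) ∷ (1ℚ , 1 , 1) ∷ []

Dy : Poly
Dy = (1ℚ , 0 , 1) ∷ (1ℚ , 2 , 0) ∷ []

-- The derivation D, defined by linearity and the Leibniz rule on monomials:
--   D(c x^i y^j) = c i x^(i-1) y^j D(x) + c j x^i y^(j-1) D(y).
Dmon : Term → Poly
Dmon (c , i , j) =
  mulPoly ((c * ℕtoℚ i , i ∸ 1 , j) ∷ []) Dx ++
  mulPoly ((c * ℕtoℚ j , i , j ∸ 1) ∷ []) Dy

D : Poly → Poly
D = concatMap Dmon

Dpow : ℕ → Poly → Poly
Dpow zero    f = f
Dpow (suc n) f = D (Dpow n f)

xPoly : Poly
xPoly = (1ℚ , 1 , 0) ∷ []

b : ℕ → ℕ → ℕ → ℚ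
b n zero    j = 0ℚ
b n (suc i) j = coeff (Dpow n xPoly) (suc i) j

Σ≤ : ℕ → (ℕ → ℚ) → ℚ
Σ≤ zero    f = f 0
Σ≤ (suc n) f = Σ≤ n f + f (suc n)

-- Formal power series in ℚ[[x,p,q]]: S n i j = coefficient of x^n p^i q^j

FPS : Set
FPS = ℕ → ℕ → ℕ → ℚ

_⊕_ : FPS → FPS → FPS
(f ⊕ g) n i j = f n i j + g n i j

_⊖_ : FPS → FPS → FPS
(f ⊖ g) n i j = f n i j - g n i j

_⊛_ : FPS → FPS → FPS
(f ⊛ g) n i j =
  Σ≤ n λ a → Σ≤ i λ c → Σ≤ j λ d → f a c d * g (n ∸ a) (i ∸ c) (j ∸ d)

scale : ℚ → FPS → FPS
scale r f n i j = r * f n i j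

oneS : FPS
oneS zero zero zero = 1ℚ
oneS _    _    _    = 0ℚ

pS : FPS
pS zero (suc zero) zero = 1ℚ
pS _    _          _    = 0ℚ

qS : FPS
qS zero zero (suc zero) = 1ℚ
qS _    _    _          = 0ℚ

powS : FPS → ℕ → FPS
powS f zero    = oneS
powS f (suc k) = f ⊛ powS f k

expS : FPS
expS n zero zero = inv! n
expS n _    _    = 0ℚ

TS : FPS
TS = expS ⊖ oneS

ΔS : FPS
ΔS = (qS ⊛ qS) ⊖ (pS ⊛ pS)

-- Ch = cosh(√Δ · T)        = Σ_k Δ^k T^(2k) / (2k)!
-- Sh = sinh(√Δ · T) / √Δ   = Σ_k Δ^k T^(2k+1) / (2k+1)!
-- Since T has no constant term, only k ≤ n contributes to the x^n
-- coefficient, so the infinite sums are computed exactly by truncation.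
ChS : FPS
ChS n i j = Σ≤ n λ k →
  scale (inv! (2 ℕ.* k)) (powS ΔS k ⊛ powS TS (2 ℕ.* k)) n i j

ShS : FPS
ShS n i j = Σ≤ n λ k →
  scale (inv! (suc (2 ℕ.* k))) (powS ΔS k ⊛ powS TS (suc (2 ℕ.* k))) n i j

BS : FPS
BS n i j = b n i j * inv! n

S : ℕ → ℕ → ℕ
S zero    zero    = 1
S zero    (suc k) = 0
S (suc n) zero    = 0
S (suc n) (suc k) = suc k ℕ.* S n (suc k) ℕ.+ S n k

insertEverywhere : ℕ → List ℕ → List (List ℕ)
insertEverywhere a []       = (a ∷ []) ∷ []
insertEverywhere a (x ∷ xs) = (a ∷ x ∷ xs) ∷ map (x ∷_) (insertEverywhere a xs)

perms : List ℕ → List (List ℕ)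
perms []       = [] ∷ []
perms (x ∷ xs) = concatMap (insertEverywhere x) (perms xs)

oneTo : ℕ → List ℕ
oneTo zero    = []
oneTo (suc m) = oneTo m ++ (suc m ∷ [])

peaksAux : List ℕ → ℕ
peaksAux (a ∷ c ∷ d ∷ rest) =
  (if (a <ᵇ c) ∧ (d <ᵇ c) then 1 else 0) ℕ.+ peaksAux (c ∷ d ∷ rest)
peaksAux _ = 0

-- left peaks of w_1…w_m with the convention w_0 = 0 (r ∈ {1,…,m-1})
leftPeaks : List ℕ → ℕ
leftPeaks w = peaksAux (0 ∷ w)

P : ℕ → ℕ → ℕ
P m k = length (filter (λ w → leftPeaks w ℕ.≟ k) (perms (oneTo m)))

-- D acts on the coefficients c a b of a polynomial by
--   c a b ↦ (a + b) c a b + a c a (b − 1) + (b + 1) c (a − 2) (b + 1).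
-- The first term multiplies the part of total degree k by k and the other two raise the degree by
-- one, so the coefficients of Dⁿ(x) in degree m + 1 are S(n + 1, m + 1) times numbers independent
-- of n.  For the odd powers of x these numbers obey the recurrence of P that comes from inserting a
-- new maximum into a permutation, which gives the formula for b n (2i − 1) j.
--
-- On ℚ[[q]][[p]][[x]] (the coefficient of xⁿ pⁱ qʲ sitting at n i j, with p and q playing the roles
-- of x and y) the same formula says that B satisfies ∂ₓB = L B for the derivation
-- L = (p + pq) ∂p + (q + p²) ∂q.  With T = eˣ − 1 and Δ = q² − p², the series
-- U = cosh(√Δ T) − q sinh(√Δ T)/√Δ and p eˣ both satisfy ∂ₓF = L F − q F, hence so does
-- W = B U − p eˣ; since W has no constant term in x, comparing coefficients of xⁿ shows W = 0.

module Submission where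

open import Algebra.Bundles using (CommutativeRing; Semiring)

module IntegerRingSolver {c ℓ} (R : CommutativeRing c ℓ) where

  open import Algebra.Solver.Ring.AlmostCommutativeRing
    using (AlmostCommutativeRing; fromCommutativeRing; _-Raw-AlmostCommutative⟶_)
  open import Data.Nat as ℕ using (ℕ; zero; suc)
  import Data.Nat.Properties as ℕ
  open import Data.Integer as ℤ using (ℤ; +_; -[1+_]; _⊖_; _◃_; sign; ∣_∣)
  import Data.Integer.Properties as ℤ
  open import Data.Sign as Sign using (Sign)
  open import Data.Maybe using (Maybe; just; nothing)
  open import Relation.Binary.PropositionalEquality as ≡ using (_≡_)
  open import Relation.Nullary using (yes; no)

  open CommutativeRing R
  open import Algebra.Properties.Ring ring using (-‿involutive; -0#≈0#; -‿distribˡ-*; -‿distribʳ-*; -‿+-comm)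
  open import Algebra.Properties.Semiring.Mult semiring using (_×_; ×-homo-+; ×1-homo-*)
  open import Relation.Binary.Reasoning.Setoid setoid

  -- The carriers below have no decidable equality, so the solver takes coefficients in ℤ.  The
  -- clause ι 1 = 1# makes the solver's constant 1 definitionally equal to 1#.
  ι : ℕ → Carrier
  ι zero          = 0#
  ι (suc zero)    = 1#
  ι (suc (suc n)) = 1# + ι (suc n)

  ι≈×1# : ∀ n → ι n ≈ n × 1#
  ι≈×1# zero          = refl
  ι≈×1# (suc zero)    = sym (+-identityʳ 1#)
  ι≈×1# (suc (suc n)) = +-congˡ (ι≈×1# (suc n))

  ι-suc : ∀ n → ι (suc n) ≈ 1# + ι n
  ι-suc n = trans (ι≈×1# (suc n)) (+-congˡ (sym (ι≈×1# n)))

  ι-+ : ∀ m n → ι (m ℕ.+ n) ≈ ι m + ι n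
  ι-+ m n = trans (ι≈×1# (m ℕ.+ n)) (trans (×-homo-+ 1# m n) (sym (+-cong (ι≈×1# m) (ι≈×1# n))))

  ι-* : ∀ m n → ι (m ℕ.* n) ≈ ι m * ι n
  ι-* m n = trans (ι≈×1# (m ℕ.* n)) (trans (×1-homo-* m n) (sym (*-cong (ι≈×1# m) (ι≈×1# n))))

  fromℤ : ℤ → Carrier
  fromℤ (+ n)    = ι n
  fromℤ -[1+ n ] = - ι (suc n)

  private
    cancel-1# : ∀ x y → x - y ≈ (1# + x) - (1# + y)
    cancel-1# x y = begin
      x - y                 ≈⟨ +-identityˡ _ ⟨
      0# + (x - y)          ≈⟨ +-congʳ (-‿inverseʳ 1#) ⟨
      (1# - 1#) + (x - y)   ≈⟨ +-assoc _ _ _ ⟩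
      1# + (- 1# + (x - y)) ≈⟨ +-congˡ (+-assoc _ _ _) ⟨
      1# + ((- 1# + x) - y) ≈⟨ +-congˡ (+-congʳ (+-comm _ _)) ⟩
      1# + ((x - 1#) - y)   ≈⟨ +-congˡ (+-assoc _ _ _) ⟩
      1# + (x + (- 1# - y)) ≈⟨ +-congˡ (+-congˡ (-‿+-comm 1# y)) ⟩
      1# + (x - (1# + y))   ≈⟨ +-assoc _ _ _ ⟨
      (1# + x) - (1# + y)   ∎

  fromℤ-⊖ : ∀ m n → fromℤ (m ⊖ n) ≈ ι m - ι n
  fromℤ-⊖ m zero = begin
    ι m      ≈⟨ +-identityʳ _ ⟨
    ι m + 0# ≈⟨ +-congˡ -0#≈0# ⟨
    ι m - 0# ∎
  fromℤ-⊖ zero (suc n) = sym (+-identityˡ _)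
  fromℤ-⊖ (suc m) (suc n) = begin
    fromℤ (suc m ⊖ suc n) ≡⟨ ≡.cong fromℤ (ℤ.[1+m]⊖[1+n]≡m⊖n m n) ⟩
    fromℤ (m ⊖ n)         ≈⟨ fromℤ-⊖ m n ⟩
    ι m - ι n             ≈⟨ cancel-1# (ι m) (ι n) ⟩
    (1# + ι m) - (1# + ι n) ≈⟨ +-cong (ι-suc m) (-‿cong (ι-suc n)) ⟨
    ι (suc m) - ι (suc n) ∎

  fromℤ-+ : ∀ i j → fromℤ (i ℤ.+ j) ≈ fromℤ i + fromℤ j
  fromℤ-+ -[1+ m ] -[1+ n ] = begin
    - ι (suc (suc (m ℕ.+ n)))   ≡⟨ ≡.cong (λ k → - ι (suc k)) (≡.sym (ℕ.+-suc m n)) ⟩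
    - ι (suc m ℕ.+ suc n)       ≈⟨ -‿cong (ι-+ (suc m) (suc n)) ⟩
    - (ι (suc m) + ι (suc n))   ≈⟨ -‿+-comm _ _ ⟨
    - ι (suc m) - ι (suc n)     ∎
  fromℤ-+ -[1+ m ] (+ n)    = trans (fromℤ-⊖ n (suc m)) (+-comm _ _)
  fromℤ-+ (+ m)    -[1+ n ] = fromℤ-⊖ m (suc n)
  fromℤ-+ (+ m)    (+ n)    = ι-+ m n

  private
    signed : Sign → Carrier → Carrier
    signed Sign.+ x = x
    signed Sign.- x = - x

    signed-cong : ∀ s {x y} → x ≈ y → signed s x ≈ signed s y
    signed-cong Sign.+ x≈y = x≈y
    signed-cong Sign.- x≈y = -‿cong x≈y

    fromℤ-◃ : ∀ s n → fromℤ (s ◃ n) ≈ signed s (ι n)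
    fromℤ-◃ Sign.+ zero    = refl
    fromℤ-◃ Sign.- zero    = sym -0#≈0#
    fromℤ-◃ Sign.+ (suc n) = refl
    fromℤ-◃ Sign.- (suc n) = refl

    signed-* : ∀ s t x y → signed (s Sign.* t) (x * y) ≈ signed s x * signed t y
    signed-* Sign.+ Sign.+ x y = refl
    signed-* Sign.+ Sign.- x y = -‿distribʳ-* x y
    signed-* Sign.- Sign.+ x y = -‿distribˡ-* x y
    signed-* Sign.- Sign.- x y = begin
      x * y         ≈⟨ -‿involutive _ ⟨
      - - (x * y)   ≈⟨ -‿cong (-‿distribˡ-* x y) ⟩
      - (- x * y)   ≈⟨ -‿distribʳ-* _ _ ⟩
      - x * - y     ∎

    signed-sign : ∀ i → signed (sign i) (ι ∣ i ∣) ≈ fromℤ i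
    signed-sign (+ n)    = refl
    signed-sign -[1+ n ] = refl

  fromℤ-* : ∀ i j → fromℤ (i ℤ.* j) ≈ fromℤ i * fromℤ j
  fromℤ-* i j = begin
    fromℤ ((sign i Sign.* sign j) ◃ (∣ i ∣ ℕ.* ∣ j ∣))
      ≈⟨ fromℤ-◃ (sign i Sign.* sign j) (∣ i ∣ ℕ.* ∣ j ∣) ⟩
    signed (sign i Sign.* sign j) (ι (∣ i ∣ ℕ.* ∣ j ∣))
      ≈⟨ signed-cong (sign i Sign.* sign j) (ι-* ∣ i ∣ ∣ j ∣) ⟩
    signed (sign i Sign.* sign j) (ι ∣ i ∣ * ι ∣ j ∣)
      ≈⟨ signed-* (sign i) (sign j) _ _ ⟩
    signed (sign i) (ι ∣ i ∣) * signed (sign j) (ι ∣ j ∣)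
      ≈⟨ *-cong (signed-sign i) (signed-sign j) ⟩
    fromℤ i * fromℤ j ∎

  fromℤ-neg : ∀ i → fromℤ (ℤ.- i) ≈ - fromℤ i
  fromℤ-neg (+ zero)  = sym -0#≈0#
  fromℤ-neg (+ suc n) = refl
  fromℤ-neg -[1+ n ]  = sym (-‿involutive _)

  fromℤ-homomorphism : ℤ.+-*-rawRing -Raw-AlmostCommutative⟶ fromCommutativeRing R
  fromℤ-homomorphism = record
    { ⟦_⟧ = fromℤ ; +-homo = fromℤ-+ ; *-homo = fromℤ-* ; -‿homo = fromℤ-neg
    ; 0-homo = refl ; 1-homo = refl }

  private
    fromℤ-≟ : ∀ i j → Maybe (fromℤ i ≈ fromℤ j)
    fromℤ-≟ i j with i ℤ.≟ j
    ... | yes ≡.refl = just refl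
    ... | no _       = nothing

  open import Algebra.Solver.Ring ℤ.+-*-rawRing (fromCommutativeRing R) fromℤ-homomorphism fromℤ-≟ public

module FiniteSums {c ℓ} (R : CommutativeRing c ℓ) where

  open import Data.Nat as ℕ using (ℕ; zero; suc; _∸_; _≤_; _<_; z≤n; s≤s)
  import Data.Nat.Properties as ℕ
  open import Data.Sum using (inj₁; inj₂)
  open import Relation.Binary.PropositionalEquality as ≡ using (_≡_; _≢_)

  open CommutativeRing R
  open import Algebra.Properties.Ring ring using (-‿+-comm)
  open import Relation.Binary.Reasoning.Setoid setoid

  Σ≤ : ℕ → (ℕ → Carrier) → Carrier
  Σ≤ zero    f = f 0
  Σ≤ (suc n) f = Σ≤ n f + f (suc n)

  Σ≤-cong≤ : ∀ n {f g} → (∀ k → k ≤ n → f k ≈ g k) → Σ≤ n f ≈ Σ≤ n g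
  Σ≤-cong≤ zero    f≈g = f≈g 0 z≤n
  Σ≤-cong≤ (suc n) f≈g = +-cong (Σ≤-cong≤ n λ k k≤n → f≈g k (ℕ.m≤n⇒m≤1+n k≤n)) (f≈g (suc n) ℕ.≤-refl)

  Σ≤-cong : ∀ n {f g} → (∀ k → f k ≈ g k) → Σ≤ n f ≈ Σ≤ n g
  Σ≤-cong n f≈g = Σ≤-cong≤ n λ k _ → f≈g k

  Σ≤-+ : ∀ n f g → Σ≤ n (λ k → f k + g k) ≈ Σ≤ n f + Σ≤ n g
  Σ≤-+ zero    f g = refl
  Σ≤-+ (suc n) f g = begin
    Σ≤ n (λ k → f k + g k) + (f (suc n) + g (suc n)) ≈⟨ +-congʳ (Σ≤-+ n f g) ⟩
    (Σ≤ n f + Σ≤ n g) + (f (suc n) + g (suc n))     ≈⟨ +-assoc _ _ _ ⟩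
    Σ≤ n f + (Σ≤ n g + (f (suc n) + g (suc n)))     ≈⟨ +-congˡ (+-assoc _ _ _) ⟨
    Σ≤ n f + ((Σ≤ n g + f (suc n)) + g (suc n))     ≈⟨ +-congˡ (+-congʳ (+-comm _ _)) ⟩
    Σ≤ n f + ((f (suc n) + Σ≤ n g) + g (suc n))     ≈⟨ +-congˡ (+-assoc _ _ _) ⟩
    Σ≤ n f + (f (suc n) + (Σ≤ n g + g (suc n)))     ≈⟨ +-assoc _ _ _ ⟨
    (Σ≤ n f + f (suc n)) + (Σ≤ n g + g (suc n))     ∎

  *-distribˡ-Σ≤ : ∀ n a f → a * Σ≤ n f ≈ Σ≤ n (λ k → a * f k)
  *-distribˡ-Σ≤ zero    a f = refl
  *-distribˡ-Σ≤ (suc n) a f = trans (distribˡ _ _ _) (+-congʳ (*-distribˡ-Σ≤ n a f))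

  *-distribʳ-Σ≤ : ∀ n a f → Σ≤ n f * a ≈ Σ≤ n (λ k → f k * a)
  *-distribʳ-Σ≤ zero    a f = refl
  *-distribʳ-Σ≤ (suc n) a f = trans (distribʳ _ _ _) (+-congʳ (*-distribʳ-Σ≤ n a f))

  -‿distrib-Σ≤ : ∀ n f → - Σ≤ n f ≈ Σ≤ n (λ k → - f k)
  -‿distrib-Σ≤ zero    f = refl
  -‿distrib-Σ≤ (suc n) f = trans (sym (-‿+-comm _ _)) (+-congʳ (-‿distrib-Σ≤ n f))

  Σ≤-zero : ∀ n {f} → (∀ k → k ≤ n → f k ≈ 0#) → Σ≤ n f ≈ 0#
  Σ≤-zero zero    f≈0 = f≈0 0 z≤n
  Σ≤-zero (suc n) f≈0 = trans (+-cong (Σ≤-zero n λ k k≤n → f≈0 k (ℕ.m≤n⇒m≤1+n k≤n)) (f≈0 (suc n) ℕ.≤-refl)) (+-identityˡ _)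

  Σ≤-head : ∀ n f → Σ≤ (suc n) f ≈ f 0 + Σ≤ n (λ k → f (suc k))
  Σ≤-head zero    f = refl
  Σ≤-head (suc n) f = trans (+-congʳ (Σ≤-head n f)) (+-assoc _ _ _)

  Σ≤-reverse : ∀ n f → Σ≤ n f ≈ Σ≤ n (λ k → f (n ∸ k))
  Σ≤-reverse zero    f = refl
  Σ≤-reverse (suc n) f = begin
    Σ≤ n f + f (suc n)                                 ≈⟨ +-comm _ _ ⟩
    f (suc n) + Σ≤ n f                                 ≈⟨ +-congˡ (Σ≤-reverse n f) ⟩
    f (suc n) + Σ≤ n (λ k → f (suc n ∸ suc k))         ≈⟨ Σ≤-head n (λ k → f (suc n ∸ k)) ⟨
    Σ≤ (suc n) (λ k → f (suc n ∸ k))                   ∎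

  Σ≤-comm : ∀ n m (F : ℕ → ℕ → Carrier) →
            Σ≤ n (λ a → Σ≤ m (F a)) ≈ Σ≤ m (λ b → Σ≤ n (λ a → F a b))
  Σ≤-comm zero    m F = refl
  Σ≤-comm (suc n) m F = begin
    Σ≤ n (λ a → Σ≤ m (F a)) + Σ≤ m (F (suc n))         ≈⟨ +-congʳ (Σ≤-comm n m F) ⟩
    Σ≤ m (λ b → Σ≤ n (λ a → F a b)) + Σ≤ m (F (suc n)) ≈⟨ Σ≤-+ m _ _ ⟨
    Σ≤ m (λ b → Σ≤ n (λ a → F a b) + F (suc n) b)      ∎

  Σ≤-triangle : ∀ n (F : ℕ → ℕ → Carrier) →
                Σ≤ n (λ c → Σ≤ c (λ a → F a c)) ≈ Σ≤ n (λ a → Σ≤ (n ∸ a) (λ b → F a (a ℕ.+ b)))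
  Σ≤-triangle zero    F = refl
  Σ≤-triangle (suc n) F = begin
    Σ≤ n (λ c → Σ≤ c (λ a → F a c)) + Σ≤ (suc n) (λ a → F a (suc n))
      ≈⟨ +-congʳ (Σ≤-triangle n F) ⟩
    Σ≤ n rows + (Σ≤ n (λ a → F a (suc n)) + F (suc n) (suc n))
      ≈⟨ +-assoc _ _ _ ⟨
    (Σ≤ n rows + Σ≤ n (λ a → F a (suc n))) + F (suc n) (suc n)
      ≈⟨ +-cong (Σ≤-+ n _ _) (reflexive (≡.cong (F (suc n)) (ℕ.+-identityʳ (suc n)))) ⟨
    Σ≤ n (λ a → rows a + F a (suc n)) + F (suc n) (suc n ℕ.+ 0)
      ≈⟨ +-cong (Σ≤-cong≤ n λ a a≤n → sym (extend-row a a≤n))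
                (reflexive (≡.cong (λ m → Σ≤ m (λ b → F (suc n) (suc n ℕ.+ b))) (≡.sym (ℕ.n∸n≡0 n)))) ⟩
    Σ≤ n (λ a → Σ≤ (suc n ∸ a) (λ b → F a (a ℕ.+ b))) + Σ≤ (suc n ∸ suc n) (λ b → F (suc n) (suc n ℕ.+ b)) ∎
    where
    rows : ℕ → Carrier
    rows a = Σ≤ (n ∸ a) (λ b → F a (a ℕ.+ b))

    extend-row : ∀ a → a ≤ n → Σ≤ (suc n ∸ a) (λ b → F a (a ℕ.+ b)) ≈ rows a + F a (suc n)
    extend-row a a≤n rewrite ℕ.+-∸-assoc 1 a≤n =
      +-congˡ (reflexive (≡.cong (F a) (≡.trans (ℕ.+-suc a (n ∸ a)) (≡.cong suc (ℕ.m+[n∸m]≡n a≤n)))))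

  Σ≤-single : ∀ n m {f} → m ≤ n → (∀ k → k ≤ n → k ≢ m → f k ≈ 0#) → Σ≤ n f ≈ f m
  Σ≤-single zero    zero    z≤n _   = refl
  Σ≤-single (suc n) m {f} m≤1+n f≈0 with ℕ.m≤n⇒m<n∨m≡n m≤1+n
  ... | inj₁ (s≤s m≤n) = begin
    Σ≤ n f + f (suc n) ≈⟨ +-cong (Σ≤-single n m m≤n λ k k≤n → f≈0 k (ℕ.m≤n⇒m≤1+n k≤n))
                                 (f≈0 (suc n) ℕ.≤-refl λ 1+n≡m → ℕ.<⇒≢ (s≤s m≤n) (≡.sym 1+n≡m)) ⟩
    f m + 0#           ≈⟨ +-identityʳ _ ⟩
    f m                ∎
  ... | inj₂ ≡.refl = begin
    Σ≤ n f + f (suc n) ≈⟨ +-congʳ (Σ≤-zero n λ k k≤n → f≈0 k (ℕ.m≤n⇒m≤1+n k≤n) (ℕ.<⇒≢ (s≤s k≤n))) ⟩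
    0# + f (suc n)     ≈⟨ +-identityˡ _ ⟩
    f (suc n)          ∎

  Σ≤-extend : ∀ n N {f} → n ≤ N → (∀ k → n < k → f k ≈ 0#) → Σ≤ N f ≈ Σ≤ n f
  Σ≤-extend n N {f} n≤N f≈0 =
    trans (reflexive (≡.cong (λ m → Σ≤ m f) (≡.sym (ℕ.m∸n+n≡m n≤N)))) (pad (N ∸ n))
    where
    pad : ∀ d → Σ≤ (d ℕ.+ n) f ≈ Σ≤ n f
    pad zero    = refl
    pad (suc d) = trans (+-cong (pad d) (f≈0 _ (s≤s (ℕ.m≤n+m n d)))) (+-identityʳ _)

module Derivations {c ℓ} (R : CommutativeRing c ℓ) where

  open import Data.Nat using (zero; suc)
  open import Data.Integer using (+_)
  open import Level using (_⊔_)

  open CommutativeRing R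
  open import Algebra.Properties.Ring ring using (x+x≈x⇒x≈0)
  open import Algebra.Definitions.RawSemiring (Semiring.rawSemiring semiring) using (_^_) public
  open import Relation.Binary.Reasoning.Setoid setoid
  open IntegerRingSolver R public

  record IsDerivation (d : Carrier → Carrier) : Set (c ⊔ ℓ) where
    field
      cong    : ∀ {x y} → x ≈ y → d x ≈ d y
      +-homo  : ∀ x y → d (x + y) ≈ d x + d y
      leibniz : ∀ x y → d (x * y) ≈ d x * y + x * d y

    0-homo : d 0# ≈ 0#
    0-homo = x+x≈x⇒x≈0 (d 0#) (sym (trans (cong (sym (+-identityʳ 0#))) (+-homo 0# 0#)))

    1-homo : d 1# ≈ 0#
    1-homo = x+x≈x⇒x≈0 (d 1#) (begin
      d 1# + d 1#           ≈⟨ +-cong (*-identityʳ _) (*-identityˡ _) ⟨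
      d 1# * 1# + 1# * d 1# ≈⟨ leibniz 1# 1# ⟨
      d (1# * 1#)           ≈⟨ cong (*-identityʳ _) ⟩
      d 1#                  ∎)

    -‿homo : ∀ x → d (- x) ≈ - d x
    -‿homo x = begin
      d (- x)                   ≈⟨ +-identityʳ _ ⟨
      d (- x) + 0#              ≈⟨ +-congˡ (-‿inverseʳ (d x)) ⟨
      d (- x) + (d x - d x)     ≈⟨ +-assoc _ _ _ ⟨
      (d (- x) + d x) - d x     ≈⟨ +-congʳ (+-homo _ _) ⟨
      d (- x + x) - d x         ≈⟨ +-congʳ (cong (-‿inverseˡ x)) ⟩
      d 0# - d x                ≈⟨ +-congʳ 0-homo ⟩
      0# - d x                  ≈⟨ +-identityˡ _ ⟩
      - d x                     ∎

    -‿-homo : ∀ x y → d (x - y) ≈ d x - d y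
    -‿-homo x y = trans (+-homo x (- y)) (+-congˡ (-‿homo y))

    leibniz-constˡ : ∀ a x → d a ≈ 0# → d (a * x) ≈ a * d x
    leibniz-constˡ a x da≈0 = begin
      d (a * x)           ≈⟨ leibniz a x ⟩
      d a * x + a * d x   ≈⟨ +-congʳ (trans (*-congʳ da≈0) (zeroˡ x)) ⟩
      0# + a * d x        ≈⟨ +-identityˡ _ ⟩
      a * d x             ∎

    ^-homo : ∀ x k → d (x ^ suc k) ≈ ι (suc k) * x ^ k * d x
    ^-homo x zero = begin
      d (x * 1#)            ≈⟨ leibniz x 1# ⟩
      d x * 1# + x * d 1#   ≈⟨ +-congˡ (*-congˡ 1-homo) ⟩
      d x * 1# + x * 0#     ≈⟨ solve 2 (λ a b → a :* con (+ 1) :+ b :* con (+ 0) := con (+ 1) :* con (+ 1) :* a) refl (d x) x ⟩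
      ι 1 * 1# * d x        ∎
    ^-homo x (suc k) = begin
      d (x * x ^ suc k)                          ≈⟨ leibniz x _ ⟩
      d x * x ^ suc k + x * d (x ^ suc k)        ≈⟨ +-congˡ (*-congˡ (^-homo x k)) ⟩
      d x * (x * x ^ k) + x * (ι (suc k) * x ^ k * d x)
        ≈⟨ solve 4 (λ a b p i → a :* (b :* p) :+ b :* (i :* p :* a) := (con (+ 1) :+ i) :* (b :* p) :* a)
                   refl (d x) x (x ^ k) (ι (suc k)) ⟩
      ι (suc (suc k)) * (x * x ^ k) * d x        ∎

    annihilates-^ : ∀ {x} k → d x ≈ 0# → d (x ^ k) ≈ 0#
    annihilates-^ zero    dx≈0 = 1-homo
    annihilates-^ {x} (suc k) dx≈0 = trans (^-homo x k) (trans (*-congˡ dx≈0) (zeroʳ _))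

  linearCombination : ∀ {d₁ d₂} (a b : Carrier) → IsDerivation d₁ → IsDerivation d₂ →
                      IsDerivation (λ x → a * d₁ x + b * d₂ x)
  linearCombination {d₁} {d₂} a b D₁ D₂ = record
    { cong    = λ x≈y → +-cong (*-congˡ (D₁.cong x≈y)) (*-congˡ (D₂.cong x≈y))
    ; +-homo  = λ x y → begin
        a * d₁ (x + y) + b * d₂ (x + y)         ≈⟨ +-cong (*-congˡ (D₁.+-homo x y)) (*-congˡ (D₂.+-homo x y)) ⟩
        a * (d₁ x + d₁ y) + b * (d₂ x + d₂ y)
          ≈⟨ solve 6 (λ a b p q r s → a :* (p :+ q) :+ b :* (r :+ s) := (a :* p :+ b :* r) :+ (a :* q :+ b :* s))
                     refl a b (d₁ x) (d₁ y) (d₂ x) (d₂ y) ⟩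
        (a * d₁ x + b * d₂ x) + (a * d₁ y + b * d₂ y) ∎
    ; leibniz = λ x y → begin
        a * d₁ (x * y) + b * d₂ (x * y)         ≈⟨ +-cong (*-congˡ (D₁.leibniz x y)) (*-congˡ (D₂.leibniz x y)) ⟩
        a * (d₁ x * y + x * d₁ y) + b * (d₂ x * y + x * d₂ y)
          ≈⟨ solve 8 (λ a b p q r s x y → a :* (p :* y :+ x :* q) :+ b :* (r :* y :+ x :* s)
                                          := (a :* p :+ b :* r) :* y :+ x :* (a :* q :+ b :* s))
                     refl a b (d₁ x) (d₁ y) (d₂ x) (d₂ y) x y ⟩
        (a * d₁ x + b * d₂ x) * y + x * (a * d₁ y + b * d₂ y) ∎
    }
    where
    module D₁ = IsDerivation D₁
    module D₂ = IsDerivation D₂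

module PowerSeries {c ℓ} (R : CommutativeRing c ℓ) where

  open import Data.Nat as ℕ using (ℕ; zero; suc; _∸_; _≤_; _<_; z≤n; s≤s)
  import Data.Nat.Properties as ℕ
  open import Data.Product using (_,_)
  open import Data.Empty using (⊥-elim)
  open import Relation.Nullary using (yes; no)
  open import Relation.Binary.PropositionalEquality as ≡ using (_≡_)

  open CommutativeRing R
  open import Relation.Binary.Reasoning.Setoid setoid
  open FiniteSums R public
  open Derivations R using (IsDerivation; ι-+)
  open Derivations R public using (ι)

  Series : Set c
  Series = ℕ → Carrier

  infix  4 _≋_
  infixl 6 _⊞_
  infixl 7 _⊠_

  _≋_ : Series → Series → Set ℓ
  f ≋ g = ∀ n → f n ≈ g n

  _⊞_ : Series → Series → Series
  (f ⊞ g) n = f n + g n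

  ⊟_ : Series → Series
  (⊟ f) n = - f n

  _⊠_ : Series → Series → Series
  (f ⊠ g) n = Σ≤ n (λ a → f a * g (n ∸ a))

  C : Carrier → Series
  C a zero    = a
  C a (suc n) = 0#

  𝟘 𝟙 X : Series
  𝟘 n = 0#
  𝟙   = C 1#
  X (suc zero) = 1#
  X _          = 0#

  ⊠-cong : ∀ {f f′ g g′} → f ≋ f′ → g ≋ g′ → f ⊠ g ≋ f′ ⊠ g′
  ⊠-cong f≋f′ g≋g′ n = Σ≤-cong n λ a → *-cong (f≋f′ a) (g≋g′ (n ∸ a))

  ⊠-comm : ∀ f g → f ⊠ g ≋ g ⊠ f
  ⊠-comm f g n = begin
    Σ≤ n (λ a → f a * g (n ∸ a))             ≈⟨ Σ≤-reverse n _ ⟩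
    Σ≤ n (λ a → f (n ∸ a) * g (n ∸ (n ∸ a)))
      ≈⟨ Σ≤-cong≤ n (λ a a≤n → trans (*-comm _ _) (*-congʳ (reflexive (≡.cong g (ℕ.m∸[m∸n]≡n a≤n))))) ⟩
    Σ≤ n (λ a → g a * f (n ∸ a))             ∎

  C-⊠ : ∀ a f → C a ⊠ f ≋ λ n → a * f n
  C-⊠ a f n = Σ≤-single n 0 z≤n λ where
    zero    _ 0≢0 → ⊥-elim (0≢0 ≡.refl)
    (suc k) _ _   → zeroˡ _

  X-⊠-zero : ∀ f → (X ⊠ f) 0 ≈ 0#
  X-⊠-zero f = zeroˡ _

  X-⊠-suc : ∀ f n → (X ⊠ f) (suc n) ≈ f n
  X-⊠-suc f n = trans (Σ≤-single (suc n) 1 (s≤s z≤n) λ where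
      zero          _ _   → zeroˡ _
      (suc zero)    _ 1≢1 → ⊥-elim (1≢1 ≡.refl)
      (suc (suc k)) _ _   → zeroˡ _)
    (*-identityˡ _)

  ⊠-assoc : ∀ f g h → (f ⊠ g) ⊠ h ≋ f ⊠ (g ⊠ h)
  ⊠-assoc f g h n = begin
    Σ≤ n (λ c → Σ≤ c (λ a → f a * g (c ∸ a)) * h (n ∸ c))      ≈⟨ Σ≤-cong n (λ c → *-distribʳ-Σ≤ c _ _) ⟩
    Σ≤ n (λ c → Σ≤ c (λ a → f a * g (c ∸ a) * h (n ∸ c)))      ≈⟨ Σ≤-triangle n _ ⟩
    Σ≤ n (λ a → Σ≤ (n ∸ a) (λ b → f a * g (a ℕ.+ b ∸ a) * h (n ∸ (a ℕ.+ b))))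
      ≈⟨ Σ≤-cong n (λ a → Σ≤-cong (n ∸ a) λ b → trans (*-assoc _ _ _)
           (*-congˡ (*-cong (reflexive (≡.cong g (ℕ.m+n∸m≡n a b)))
                            (reflexive (≡.cong h (≡.sym (ℕ.∸-+-assoc n a b))))))) ⟩
    Σ≤ n (λ a → Σ≤ (n ∸ a) (λ b → f a * (g b * h (n ∸ a ∸ b)))) ≈⟨ Σ≤-cong n (λ a → *-distribˡ-Σ≤ (n ∸ a) _ _) ⟨
    Σ≤ n (λ a → f a * Σ≤ (n ∸ a) (λ b → g b * h (n ∸ a ∸ b)))  ∎

  commutativeRing : CommutativeRing c ℓ
  commutativeRing = record
    { Carrier = Series ; _≈_ = _≋_ ; _+_ = _⊞_ ; _*_ = _⊠_ ; -_ = ⊟_ ; 0# = 𝟘 ; 1# = 𝟙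
    ; isCommutativeRing = record
      { isRing = record
        { +-isAbelianGroup = record
          { isGroup = record
            { isMonoid = record
              { isSemigroup = record
                { isMagma = record
                  { isEquivalence = record
                    { refl = λ _ → refl ; sym = λ f≋g n → sym (f≋g n) ; trans = λ f≋g g≋h n → trans (f≋g n) (g≋h n) }
                  ; ∙-cong = λ f≋f′ g≋g′ n → +-cong (f≋f′ n) (g≋g′ n) }
                ; assoc = λ _ _ _ _ → +-assoc _ _ _ }
              ; identity = (λ _ _ → +-identityˡ _) , (λ _ _ → +-identityʳ _) }
            ; inverse = (λ _ _ → -‿inverseˡ _) , (λ _ _ → -‿inverseʳ _)
            ; ⁻¹-cong = λ f≋g n → -‿cong (f≋g n) }
          ; comm = λ _ _ _ → +-comm _ _ }
        ; *-cong = ⊠-cong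
        ; *-assoc = ⊠-assoc
        ; *-identity = 𝟙-⊠ , λ f n → trans (⊠-comm f 𝟙 n) (𝟙-⊠ f n)
        ; distrib = (λ h f g n → trans (Σ≤-cong n λ _ → distribˡ _ _ _) (Σ≤-+ n _ _))
                  , (λ h f g n → trans (Σ≤-cong n λ _ → distribʳ _ _ _) (Σ≤-+ n _ _)) }
      ; *-comm = ⊠-comm } }
    where
    𝟙-⊠ : ∀ f → 𝟙 ⊠ f ≋ f
    𝟙-⊠ f n = trans (C-⊠ 1# f n) (*-identityˡ _)

  module SeriesRing = Derivations commutativeRing

  Σ≤-apply : ∀ n (h : ℕ → Series) k → FiniteSums.Σ≤ commutativeRing n h k ≡ Σ≤ n (λ a → h a k)
  Σ≤-apply zero    h k = ≡.refl
  Σ≤-apply (suc n) h k = ≡.cong (_+ h (suc n) k) (Σ≤-apply n h k)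

  C-cong : ∀ {a b} → a ≈ b → C a ≋ C b
  C-cong a≈b zero    = a≈b
  C-cong a≈b (suc n) = refl

  C-+ : ∀ a b → C (a + b) ≋ C a ⊞ C b
  C-+ a b zero    = refl
  C-+ a b (suc n) = sym (+-identityˡ _)

  C-* : ∀ a b → C (a * b) ≋ C a ⊠ C b
  C-* a b n = sym (trans (C-⊠ a (C b) n) (a*Cb n))
    where
    a*Cb : ∀ n → a * C b n ≈ C (a * b) n
    a*Cb zero    = refl
    a*Cb (suc n) = zeroʳ _

  C-ι : ∀ k → SeriesRing.ι k ≋ C (ι k)
  C-ι zero          zero    = refl
  C-ι zero          (suc n) = refl
  C-ι (suc zero)    n       = refl
  C-ι (suc (suc k)) n       = trans (+-congˡ (C-ι (suc k) n)) (sym (C-+ 1# (ι (suc k)) n))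

  ∂ : Series → Series
  ∂ f n = ι (suc n) * f (suc n)

  ∂-isDerivation : SeriesRing.IsDerivation ∂
  ∂-isDerivation = record
    { cong    = λ f≋g n → *-congˡ (f≋g (suc n))
    ; +-homo  = λ f g n → distribˡ _ _ _
    ; leibniz = leibniz }
    where
    ι-split : ∀ n a → a ≤ n → ι n ≈ ι a + ι (n ∸ a)
    ι-split n a a≤n = trans (reflexive (≡.cong ι (≡.sym (ℕ.m+[n∸m]≡n a≤n)))) (ι-+ a (n ∸ a))

    leibniz : ∀ f g n → ∂ (f ⊠ g) n ≈ (∂ f ⊠ g ⊞ f ⊠ ∂ g) n
    leibniz f g n = begin
      ι (suc n) * Σ≤ (suc n) (λ a → f a * g (suc n ∸ a))
        ≈⟨ *-distribˡ-Σ≤ (suc n) _ _ ⟩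
      Σ≤ (suc n) (λ a → ι (suc n) * (f a * g (suc n ∸ a)))
        ≈⟨ Σ≤-cong≤ (suc n) (λ a a≤ → trans (*-congʳ (ι-split (suc n) a a≤)) (distribʳ _ _ _)) ⟩
      Σ≤ (suc n) (λ a → ι a * (f a * g (suc n ∸ a)) + ι (suc n ∸ a) * (f a * g (suc n ∸ a)))
        ≈⟨ Σ≤-+ (suc n) _ _ ⟩
      Σ≤ (suc n) (λ a → ι a * (f a * g (suc n ∸ a))) + Σ≤ (suc n) (λ a → ι (suc n ∸ a) * (f a * g (suc n ∸ a)))
        ≈⟨ +-congʳ (Σ≤-head n _) ⟩
      (0# * (f 0 * g (suc n)) + Σ≤ n (λ a → ι (suc a) * (f (suc a) * g (n ∸ a))))
        + (Σ≤ n (λ a → ι (suc n ∸ a) * (f a * g (suc n ∸ a))) + ι (suc n ∸ suc n) * (f (suc n) * g (suc n ∸ suc n)))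
        ≈⟨ +-cong (trans (+-congʳ (zeroˡ _)) (+-identityˡ _))
                  (trans (+-congˡ (trans (*-congʳ (reflexive (≡.cong ι (ℕ.n∸n≡0 n)))) (zeroˡ _))) (+-identityʳ _)) ⟩
      Σ≤ n (λ a → ι (suc a) * (f (suc a) * g (n ∸ a))) + Σ≤ n (λ a → ι (suc n ∸ a) * (f a * g (suc n ∸ a)))
        ≈⟨ +-cong (Σ≤-cong n λ a → sym (*-assoc _ _ _))
                  (Σ≤-cong≤ n λ a a≤n → trans (reflexive (≡.cong (λ m → ι m * (f a * g m)) (ℕ.+-∸-assoc 1 a≤n)))
                                          (trans (sym (*-assoc _ _ _)) (trans (*-congʳ (*-comm _ _)) (*-assoc _ _ _)))) ⟩
      Σ≤ n (λ a → ι (suc a) * f (suc a) * g (n ∸ a)) + Σ≤ n (λ a → f a * (ι (suc (n ∸ a)) * g (suc (n ∸ a)))) ∎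

  ∂-C : ∀ a → ∂ (C a) ≋ 𝟘
  ∂-C a n = zeroʳ _

  ∂-X : ∂ X ≋ 𝟙
  ∂-X zero    = *-identityʳ _
  ∂-X (suc n) = zeroʳ _

  lift : (Carrier → Carrier) → Series → Series
  lift d f n = d (f n)

  module _ {d : Carrier → Carrier} (D : IsDerivation d) where
    open IsDerivation D

    d-Σ≤ : ∀ n h → d (Σ≤ n h) ≈ Σ≤ n (λ k → d (h k))
    d-Σ≤ zero    h = refl
    d-Σ≤ (suc n) h = trans (+-homo _ _) (+-congʳ (d-Σ≤ n h))

    lift-isDerivation : SeriesRing.IsDerivation (lift d)
    lift-isDerivation = record
      { cong    = λ f≋g n → cong (f≋g n)
      ; +-homo  = λ f g n → +-homo _ _
      ; leibniz = λ f g n → trans (d-Σ≤ n _) (trans (Σ≤-cong n λ a → leibniz _ _) (Σ≤-+ n _ _)) }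

    lift-C : ∀ a → lift d (C a) ≋ C (d a)
    lift-C a zero    = refl
    lift-C a (suc n) = 0-homo

  VanishesBelow : ℕ → Series → Set ℓ
  VanishesBelow k f = ∀ n → n < k → f n ≈ 0#

  vanishesBelow-⊠ : ∀ a b {f g} → VanishesBelow a f → VanishesBelow b g → VanishesBelow (a ℕ.+ b) (f ⊠ g)
  vanishesBelow-⊠ a b {f} {g} f≈0 g≈0 n n<a+b = Σ≤-zero n term
    where
    term : ∀ i → i ≤ n → f i * g (n ∸ i) ≈ 0#
    term i i≤n with i ℕ.<? a
    ... | yes i<a = trans (*-congʳ (f≈0 i i<a)) (zeroˡ _)
    ... | no  i≮a = trans (*-congˡ (g≈0 _ n∸i<b)) (zeroʳ _)
      where
      a≤i = ℕ.≮⇒≥ i≮a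
      n∸i<b : n ∸ i < b
      n∸i<b = ℕ.≤-<-trans (ℕ.∸-monoʳ-≤ n a≤i)
        (ℕ.+-cancelˡ-< a _ _ (≡.subst (ℕ._< a ℕ.+ b) (≡.sym (ℕ.m+[n∸m]≡n (ℕ.≤-trans a≤i i≤n))) n<a+b))

  vanishesBelow-⊠ˡ : ∀ k f {g} → VanishesBelow k g → VanishesBelow k (f ⊠ g)
  vanishesBelow-⊠ˡ k f = vanishesBelow-⊠ 0 k (λ _ ())

  vanishesBelow-^ : ∀ {f} → VanishesBelow 1 f → ∀ k → VanishesBelow k (f SeriesRing.^ k)
  vanishesBelow-^ f≈0 zero    n ()
  vanishesBelow-^ f≈0 (suc k) = vanishesBelow-⊠ 1 k f≈0 (vanishesBelow-^ f≈0 k)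

  vanishesBelow-≤ : ∀ {a b f} → b ≤ a → VanishesBelow a f → VanishesBelow b f
  vanishesBelow-≤ b≤a f≈0 n n<b = f≈0 n (ℕ.<-≤-trans n<b b≤a)

  -- For a Summable family only G 0, …, G n contribute to the coefficient of xⁿ.
  Σ∞ : (ℕ → Series) → Series
  Σ∞ G n = Σ≤ n (λ k → G k n)

  Summable : (ℕ → Series) → Set ℓ
  Summable G = ∀ k → VanishesBelow k (G k)

  Σ∞-cong : ∀ {G H} → (∀ k → G k ≋ H k) → Σ∞ G ≋ Σ∞ H
  Σ∞-cong G≋H n = Σ≤-cong n λ k → G≋H k n

  Σ∞-+ : ∀ G H → Σ∞ (λ k → G k ⊞ H k) ≋ Σ∞ G ⊞ Σ∞ H
  Σ∞-+ G H n = Σ≤-+ n _ _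

  Σ∞-⊟ : ∀ G → Σ∞ (λ k → ⊟ G k) ≋ ⊟ Σ∞ G
  Σ∞-⊟ G n = sym (-‿distrib-Σ≤ n _)

  ⊠-Σ∞ : ∀ f {G} → Summable G → f ⊠ Σ∞ G ≋ Σ∞ (λ k → f ⊠ G k)
  ⊠-Σ∞ f {G} G-summable n = begin
    Σ≤ n (λ a → f a * Σ≤ (n ∸ a) (λ k → G k (n ∸ a)))
      ≈⟨ Σ≤-cong n (λ a → *-congˡ (sym (Σ≤-extend (n ∸ a) n (ℕ.m∸n≤m n a) λ k → G-summable k (n ∸ a)))) ⟩
    Σ≤ n (λ a → f a * Σ≤ n (λ k → G k (n ∸ a)))    ≈⟨ Σ≤-cong n (λ a → *-distribˡ-Σ≤ n _ _) ⟩
    Σ≤ n (λ a → Σ≤ n (λ k → f a * G k (n ∸ a)))    ≈⟨ Σ≤-comm n n _ ⟩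
    Σ≤ n (λ k → Σ≤ n (λ a → f a * G k (n ∸ a)))    ∎

  lift-Σ∞ : ∀ {d} → IsDerivation d → ∀ G → lift d (Σ∞ G) ≋ Σ∞ (λ k → lift d (G k))
  lift-Σ∞ D G n = d-Σ≤ D n _

  ∂-Σ∞ : ∀ G → (∀ n → G (suc n) (suc n) ≈ 0#) → ∂ (Σ∞ G) ≋ Σ∞ (λ k → ∂ (G k))
  ∂-Σ∞ G G≈0 n = begin
    ι (suc n) * (Σ≤ n (λ k → G k (suc n)) + G (suc n) (suc n)) ≈⟨ *-congˡ (trans (+-congˡ (G≈0 n)) (+-identityʳ _)) ⟩
    ι (suc n) * Σ≤ n (λ k → G k (suc n))                       ≈⟨ *-distribˡ-Σ≤ n _ _ ⟩
    Σ≤ n (λ k → ι (suc n) * G k (suc n))                       ∎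

  Σ∞-shift : ∀ G H → G 0 ≋ 𝟘 → (∀ k → G (suc k) ≋ H k) → (∀ n → H n n ≈ 0#) → Σ∞ G ≋ Σ∞ H
  Σ∞-shift G H G₀≋0 G≋H H≈0 zero = trans (G₀≋0 0) (sym (H≈0 0))
  Σ∞-shift G H G₀≋0 G≋H H≈0 (suc n) = begin
    Σ≤ (suc n) (λ k → G k (suc n))                   ≈⟨ Σ≤-head n _ ⟩
    G 0 (suc n) + Σ≤ n (λ k → G (suc k) (suc n))     ≈⟨ +-cong (G₀≋0 (suc n)) (Σ≤-cong n λ k → G≋H k (suc n)) ⟩
    0# + Σ≤ n (λ k → H k (suc n))                    ≈⟨ +-identityˡ _ ⟩
    Σ≤ n (λ k → H k (suc n))                         ≈⟨ trans (+-congˡ (H≈0 (suc n))) (+-identityʳ _) ⟨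
    Σ≤ n (λ k → H k (suc n)) + H (suc n) (suc n)     ∎

module RationalFacts where

  open import Data.Nat as ℕ using (ℕ; zero; suc; _!)
  import Data.Nat.Properties as ℕ
  open import Data.Nat.Properties using (_!≢0)
  open import Data.Nat.Coprimality using (1-coprimeTo) renaming (sym to coprime-sym)
  open import Data.Integer as ℤ using (+_)
  open import Data.Integer.Properties using (+◃n≡+n)
  open import Data.Rational using (ℚ; mkℚ; _+_; _*_; _/_; 0ℚ; 1ℚ; 1/_)
  open import Data.Rational.Properties
    using (normalize-coprime; /-cong; *-inverseʳ; *-identityˡ; *-identityʳ; *-assoc; *-comm; *-zeroʳ
          ; +-*-commutativeRing)
  open import Relation.Binary.PropositionalEquality
  open ≡-Reasoning
  open import Defs using (ℕtoℚ; inv!)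

  private
    mkℚ-ℕ : ℕ → ℚ
    mkℚ-ℕ n = mkℚ (+ n) 0 (coprime-sym (1-coprimeTo n))

    ℕtoℚ≡mkℚ-ℕ : ∀ n → ℕtoℚ n ≡ mkℚ-ℕ n
    ℕtoℚ≡mkℚ-ℕ n = normalize-coprime (coprime-sym (1-coprimeTo n))

  ℕtoℚ-suc : ∀ n → ℕtoℚ (suc n) ≡ 1ℚ + ℕtoℚ n
  ℕtoℚ-suc n = begin
    ℕtoℚ (suc n)     ≡⟨ /-cong {p₂ = + suc n} (cong (λ i → + 1 ℤ.+ i) (trans (+◃n≡+n (n ℕ.* 1)) (cong +_ (ℕ.*-identityʳ n)))) refl ⟨
    1ℚ + mkℚ-ℕ n     ≡⟨ cong (λ r → 1ℚ + r) (ℕtoℚ≡mkℚ-ℕ n) ⟨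
    1ℚ + ℕtoℚ n      ∎

  open Derivations +-*-commutativeRing using (ι; ι-+; ι-*)

  ι≡ℕtoℚ : ∀ n → ι n ≡ ℕtoℚ n
  ι≡ℕtoℚ zero          = refl
  ι≡ℕtoℚ (suc zero)    = refl
  ι≡ℕtoℚ (suc (suc n)) = trans (cong (λ r → 1ℚ + r) (ι≡ℕtoℚ (suc n))) (sym (ℕtoℚ-suc (suc n)))

  ℕtoℚ-+ : ∀ m n → ℕtoℚ (m ℕ.+ n) ≡ ℕtoℚ m + ℕtoℚ n
  ℕtoℚ-+ m n = trans (sym (ι≡ℕtoℚ (m ℕ.+ n))) (trans (ι-+ m n) (cong₂ _+_ (ι≡ℕtoℚ m) (ι≡ℕtoℚ n)))

  ℕtoℚ-* : ∀ m n → ℕtoℚ (m ℕ.* n) ≡ ℕtoℚ m * ℕtoℚ n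
  ℕtoℚ-* m n = trans (sym (ι≡ℕtoℚ (m ℕ.* n))) (trans (ι-* m n) (cong₂ _*_ (ι≡ℕtoℚ m) (ι≡ℕtoℚ n)))

  ℕtoℚ-*-inverseʳ : ∀ d .{{_ : ℕ.NonZero d}} → ℕtoℚ d * (+ 1 / d) ≡ 1ℚ
  ℕtoℚ-*-inverseʳ (suc k) = begin
    ℕtoℚ (suc k) * (+ 1 / suc k)     ≡⟨ cong₂ _*_ (ℕtoℚ≡mkℚ-ℕ (suc k)) (normalize-coprime (1-coprimeTo (suc k))) ⟩
    mkℚ-ℕ (suc k) * 1/ mkℚ-ℕ (suc k) ≡⟨ *-inverseʳ (mkℚ-ℕ (suc k)) ⟩
    1ℚ                               ∎

  private
    inverse-unique : ∀ a x y → a * x ≡ 1ℚ → a * y ≡ 1ℚ → x ≡ y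
    inverse-unique a x y ax≡1 ay≡1 = begin
      x           ≡⟨ *-identityʳ x ⟨
      x * 1ℚ      ≡⟨ cong (x *_) ay≡1 ⟨
      x * (a * y) ≡⟨ *-assoc x a y ⟨
      (x * a) * y ≡⟨ cong (_* y) (trans (*-comm x a) ax≡1) ⟩
      1ℚ * y      ≡⟨ *-identityˡ y ⟩
      y           ∎

  ℕtoℚ-suc-*-inv!-suc : ∀ n → ℕtoℚ (suc n) * inv! (suc n) ≡ inv! n
  ℕtoℚ-suc-*-inv!-suc n = inverse-unique (ℕtoℚ (n !)) _ _ n!*[1+n]/[1+n]!≡1 (ℕtoℚ-*-inverseʳ (n !) {{n !≢0}})
    where
    n!*[1+n]/[1+n]!≡1 : ℕtoℚ (n !) * (ℕtoℚ (suc n) * inv! (suc n)) ≡ 1ℚ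
    n!*[1+n]/[1+n]!≡1 = begin
      ℕtoℚ (n !) * (ℕtoℚ (suc n) * inv! (suc n))  ≡⟨ *-assoc (ℕtoℚ (n !)) (ℕtoℚ (suc n)) (inv! (suc n)) ⟨
      (ℕtoℚ (n !) * ℕtoℚ (suc n)) * inv! (suc n)  ≡⟨ cong (_* inv! (suc n)) (trans (*-comm (ℕtoℚ (n !)) _) (sym (ℕtoℚ-* (suc n) (n !)))) ⟩
      ℕtoℚ (suc n !) * inv! (suc n)               ≡⟨ ℕtoℚ-*-inverseʳ (suc n !) {{suc n !≢0}} ⟩
      1ℚ                                          ∎

  ℕtoℚ-suc-*-cancel : ∀ k x → ℕtoℚ (suc k) * x ≡ 0ℚ → x ≡ 0ℚ
  ℕtoℚ-suc-*-cancel k x [1+k]x≡0 = begin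
    x                                      ≡⟨ *-identityˡ x ⟨
    1ℚ * x                                 ≡⟨ cong (_* x) (trans (*-comm (+ 1 / suc k) (ℕtoℚ (suc k))) (ℕtoℚ-*-inverseʳ (suc k))) ⟨
    ((+ 1 / suc k) * ℕtoℚ (suc k)) * x     ≡⟨ *-assoc (+ 1 / suc k) (ℕtoℚ (suc k)) x ⟩
    (+ 1 / suc k) * (ℕtoℚ (suc k) * x)     ≡⟨ cong ((+ 1 / suc k) *_) [1+k]x≡0 ⟩
    (+ 1 / suc k) * 0ℚ                     ≡⟨ *-zeroʳ (+ 1 / suc k) ⟩
    0ℚ                                     ∎

module KroneckerDelta where

  open import Data.Nat using (ℕ; _≡ᵇ_; _*_)
  import Data.Nat.Properties as ℕ
  open import Data.Bool using (true; false; T; if_then_else_)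
  open import Relation.Binary.PropositionalEquality

  δ : ℕ → ℕ → ℕ
  δ x y = if x ≡ᵇ y then 1 else 0

  δ-subst : ∀ (h : ℕ → ℕ) x y → h x * δ x y ≡ h y * δ x y
  δ-subst h x y with x ≡ᵇ y in x≡ᵇy
  ... | true  = cong (λ z → h z * 1) (ℕ.≡ᵇ⇒≡ x y (subst T (sym x≡ᵇy) _))
  ... | false = trans (ℕ.*-zeroʳ (h x)) (sym (ℕ.*-zeroʳ (h y)))

module CoefficientsOfD where

  open import Data.Nat as ℕ using (ℕ; zero; suc; _∸_; _≡ᵇ_)
  import Data.Nat.Properties as ℕ
  open import Data.Nat.Tactic.RingSolver using (solve-∀)
  open import Data.Bool using (true; false; _∧_; if_then_else_)
  open import Data.List using ([]; _∷_; _++_)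
  open import Data.Product using (_,_)
  open import Data.Rational using (ℚ; _+_; _*_; 0ℚ; 1ℚ)
  import Data.Rational.Properties as ℚ
  open import Data.Rational.Solver using (module +-*-Solver)
  open import Relation.Binary.PropositionalEquality
  open ≡-Reasoning
  open import Defs using (ℕtoℚ; coeff; Dmon; D; Dpow; xPoly; b)
  open RationalFacts
  open KroneckerDelta

  module _ {A : Set} (z : A) where

    yShift : (ℕ → ℕ → A) → ℕ → ℕ → A
    yShift g a zero    = z
    yShift g a (suc b) = g a b

    x²y⁻¹Shift : (ℕ → ℕ → A) → ℕ → ℕ → A
    x²y⁻¹Shift g (suc (suc a)) b = g a (suc b)
    x²y⁻¹Shift g _             b = z

  DCoeff : (ℕ → ℕ → ℚ) → ℕ → ℕ → ℚ
  DCoeff g a b = ℕtoℚ (a ℕ.+ b) * g a b + ℕtoℚ a * yShift 0ℚ g a b + ℕtoℚ (suc b) * x²y⁻¹Shift 0ℚ g a b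

  DCoeffℕ : (ℕ → ℕ → ℕ) → ℕ → ℕ → ℕ
  DCoeffℕ g a b = (a ℕ.+ b) ℕ.* g a b ℕ.+ a ℕ.* yShift 0 g a b ℕ.+ suc b ℕ.* x²y⁻¹Shift 0 g a b

  module _ {A B : Set} {z : A} {z′ : B} (h : A → B) (h-z : h z ≡ z′) (g : ℕ → ℕ → A) where

    yShift-map : ∀ a b → h (yShift z g a b) ≡ yShift z′ (λ a b → h (g a b)) a b
    yShift-map a zero    = h-z
    yShift-map a (suc b) = refl

    x²y⁻¹Shift-map : ∀ a b → h (x²y⁻¹Shift z g a b) ≡ x²y⁻¹Shift z′ (λ a b → h (g a b)) a b
    x²y⁻¹Shift-map zero          b = h-z
    x²y⁻¹Shift-map (suc zero)    b = h-z
    x²y⁻¹Shift-map (suc (suc a)) b = refl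

  module _ {A : Set} {z : A} {g h : ℕ → ℕ → A} (g≗h : ∀ a b → g a b ≡ h a b) where

    yShift-cong : ∀ a b → yShift z g a b ≡ yShift z h a b
    yShift-cong a zero    = refl
    yShift-cong a (suc b) = g≗h a b

    x²y⁻¹Shift-cong : ∀ a b → x²y⁻¹Shift z g a b ≡ x²y⁻¹Shift z h a b
    x²y⁻¹Shift-cong zero          b = refl
    x²y⁻¹Shift-cong (suc zero)    b = refl
    x²y⁻¹Shift-cong (suc (suc a)) b = g≗h a (suc b)

  DCoeff-cong : ∀ {g h} → (∀ a b → g a b ≡ h a b) → ∀ a b → DCoeff g a b ≡ DCoeff h a b
  DCoeff-cong g≗h a b =
    cong₂ _+_ (cong₂ _+_ (cong (ℕtoℚ (a ℕ.+ b) *_) (g≗h a b)) (cong (ℕtoℚ a *_) (yShift-cong g≗h a b)))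
              (cong (ℕtoℚ (suc b) *_) (x²y⁻¹Shift-cong g≗h a b))

  ℕtoℚ-DCoeffℕ : ∀ g a b → ℕtoℚ (DCoeffℕ g a b) ≡ DCoeff (λ a b → ℕtoℚ (g a b)) a b
  ℕtoℚ-DCoeffℕ g a b = begin
    ℕtoℚ ((a ℕ.+ b) ℕ.* g a b ℕ.+ a ℕ.* yShift 0 g a b ℕ.+ suc b ℕ.* x²y⁻¹Shift 0 g a b)
      ≡⟨ ℕtoℚ-+ ((a ℕ.+ b) ℕ.* g a b ℕ.+ a ℕ.* yShift 0 g a b) (suc b ℕ.* x²y⁻¹Shift 0 g a b) ⟩
    ℕtoℚ ((a ℕ.+ b) ℕ.* g a b ℕ.+ a ℕ.* yShift 0 g a b) + ℕtoℚ (suc b ℕ.* x²y⁻¹Shift 0 g a b)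
      ≡⟨ cong₂ _+_ (trans (ℕtoℚ-+ ((a ℕ.+ b) ℕ.* g a b) (a ℕ.* yShift 0 g a b))
                          (cong₂ _+_ (ℕtoℚ-* (a ℕ.+ b) (g a b)) (ℕtoℚ-* a (yShift 0 g a b))))
                   (ℕtoℚ-* (suc b) (x²y⁻¹Shift 0 g a b)) ⟩
    ℕtoℚ (a ℕ.+ b) * ℕtoℚ (g a b) + ℕtoℚ a * ℕtoℚ (yShift 0 g a b) + ℕtoℚ (suc b) * ℕtoℚ (x²y⁻¹Shift 0 g a b)
      ≡⟨ cong₂ _+_ (cong (λ r → ℕtoℚ (a ℕ.+ b) * ℕtoℚ (g a b) + ℕtoℚ a * r) (yShift-map ℕtoℚ refl g a b))
                   (cong (ℕtoℚ (suc b) *_) (x²y⁻¹Shift-map ℕtoℚ refl g a b)) ⟩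
    DCoeff (λ a b → ℕtoℚ (g a b)) a b ∎

  DCoeff-*ʳ : ∀ g e a b → DCoeff (λ a b → g a b * e) a b ≡ DCoeff g a b * e
  DCoeff-*ʳ g e a b = begin
    DCoeff (λ a b → g a b * e) a b
      ≡⟨ cong₂ _+_ (cong (λ r → ℕtoℚ (a ℕ.+ b) * (g a b * e) + ℕtoℚ a * r) (sym (yShift-map (_* e) (ℚ.*-zeroˡ e) g a b)))
                   (cong (ℕtoℚ (suc b) *_) (sym (x²y⁻¹Shift-map (_* e) (ℚ.*-zeroˡ e) g a b))) ⟩
    ℕtoℚ (a ℕ.+ b) * (g a b * e) + ℕtoℚ a * (yShift 0ℚ g a b * e) + ℕtoℚ (suc b) * (x²y⁻¹Shift 0ℚ g a b * e)
      ≡⟨ solve 7 (λ m n k x y z e → m :* (x :* e) :+ n :* (y :* e) :+ k :* (z :* e) := (m :* x :+ n :* y :+ k :* z) :* e)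
               refl (ℕtoℚ (a ℕ.+ b)) (ℕtoℚ a) (ℕtoℚ (suc b)) (g a b) (yShift 0ℚ g a b) (x²y⁻¹Shift 0ℚ g a b) e ⟩
    DCoeff g a b * e ∎
    where open +-*-Solver

  mono : ℕ → ℕ → ℕ → ℕ → ℕ
  mono i j a b = δ i a ℕ.* δ j b

  coeff-∷ : ∀ c i j f a b → coeff ((c , i , j) ∷ f) a b ≡ c * ℕtoℚ (mono i j a b) + coeff f a b
  coeff-∷ c i j f a b with i ≡ᵇ a | j ≡ᵇ b
  ... | true  | true  = cong (_+ coeff f a b) (sym (ℚ.*-identityʳ c))
  ... | true  | false = cong (_+ coeff f a b) (sym (ℚ.*-zeroʳ c))
  ... | false | true  = cong (_+ coeff f a b) (sym (ℚ.*-zeroʳ c))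
  ... | false | false = cong (_+ coeff f a b) (sym (ℚ.*-zeroʳ c))

  coeff-++ : ∀ f g a b → coeff (f ++ g) a b ≡ coeff f a b + coeff g a b
  coeff-++ []                g a b = sym (ℚ.+-identityˡ _)
  coeff-++ ((c , i , j) ∷ f) g a b =
    trans (cong (λ r → (if (i ≡ᵇ a) ∧ (j ≡ᵇ b) then c else 0ℚ) + r) (coeff-++ f g a b))
          (sym (ℚ.+-assoc (if (i ≡ᵇ a) ∧ (j ≡ᵇ b) then c else 0ℚ) (coeff f a b) (coeff g a b)))

  *-mono-diagonal : ∀ i j a b → (a ℕ.+ b) ℕ.* mono i j a b ≡ i ℕ.* mono i j a b ℕ.+ j ℕ.* mono i j a b
  *-mono-diagonal i j a b = begin
    (a ℕ.+ b) ℕ.* (δ i a ℕ.* δ j b)                  ≡⟨ ℕ.*-distribʳ-+ _ a b ⟩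
    a ℕ.* (δ i a ℕ.* δ j b) ℕ.+ b ℕ.* (δ i a ℕ.* δ j b)
      ≡⟨ cong₂ ℕ._+_ (scale-first i a (δ j b))
                     (trans (cong (b ℕ.*_) (ℕ.*-comm (δ i a) (δ j b)))
                            (trans (scale-first j b (δ i a)) (cong (j ℕ.*_) (ℕ.*-comm (δ j b) (δ i a))))) ⟩
    i ℕ.* (δ i a ℕ.* δ j b) ℕ.+ j ℕ.* (δ i a ℕ.* δ j b) ∎
    where
    scale-first : ∀ x y z → y ℕ.* (δ x y ℕ.* z) ≡ x ℕ.* (δ x y ℕ.* z)
    scale-first x y z = trans (sym (ℕ.*-assoc y (δ x y) z)) (trans (cong (ℕ._* z) (sym (δ-subst (λ n → n) x y))) (ℕ.*-assoc x (δ x y) z))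

  *-yShift-mono : ∀ i j a b → a ℕ.* yShift 0 (mono i j) a b ≡ i ℕ.* mono i (suc j) a b
  *-yShift-mono i j a zero    = trans (ℕ.*-zeroʳ a) (sym (trans (cong (i ℕ.*_) (ℕ.*-zeroʳ (δ i a))) (ℕ.*-zeroʳ i)))
  *-yShift-mono i j a (suc b) =
    trans (sym (ℕ.*-assoc a (δ i a) (δ j b))) (trans (cong (ℕ._* δ j b) (sym (δ-subst (λ n → n) i a))) (ℕ.*-assoc i (δ i a) (δ j b)))

  *-x²y⁻¹Shift-mono : ∀ i j a b → suc b ℕ.* x²y⁻¹Shift 0 (mono i j) a b ≡ j ℕ.* mono (suc (suc i)) (j ∸ 1) a b
  *-x²y⁻¹Shift-mono i j       zero          b = trans (ℕ.*-zeroʳ (suc b)) (sym (ℕ.*-zeroʳ j))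
  *-x²y⁻¹Shift-mono i j       (suc zero)    b = trans (ℕ.*-zeroʳ (suc b)) (sym (ℕ.*-zeroʳ j))
  *-x²y⁻¹Shift-mono i zero    (suc (suc a)) b = trans (cong (suc b ℕ.*_) (ℕ.*-zeroʳ (δ i a))) (ℕ.*-zeroʳ (suc b))
  *-x²y⁻¹Shift-mono i (suc j) (suc (suc a)) b = begin
    suc b ℕ.* (δ i a ℕ.* δ j b)  ≡⟨ cong (suc b ℕ.*_) (ℕ.*-comm (δ i a) (δ j b)) ⟩
    suc b ℕ.* (δ j b ℕ.* δ i a)  ≡⟨ ℕ.*-assoc (suc b) (δ j b) (δ i a) ⟨
    suc b ℕ.* δ j b ℕ.* δ i a    ≡⟨ cong (ℕ._* δ i a) (cong (δ j b ℕ.+_) (sym (δ-subst (λ n → n) j b))) ⟩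
    suc j ℕ.* δ j b ℕ.* δ i a    ≡⟨ ℕ.*-assoc (suc j) (δ j b) (δ i a) ⟩
    suc j ℕ.* (δ j b ℕ.* δ i a)  ≡⟨ cong (suc j ℕ.*_) (ℕ.*-comm (δ j b) (δ i a)) ⟩
    suc j ℕ.* (δ i a ℕ.* δ j b)  ∎

  DCoeffℕ-mono : ∀ i j a b → DCoeffℕ (mono i j) a b ≡
                 (i ℕ.* mono i j a b ℕ.+ i ℕ.* mono i (suc j) a b) ℕ.+ (j ℕ.* mono i j a b ℕ.+ j ℕ.* mono (suc (suc i)) (j ∸ 1) a b)
  DCoeffℕ-mono i j a b
    rewrite *-mono-diagonal i j a b | *-yShift-mono i j a b | *-x²y⁻¹Shift-mono i j a b =
    regroup (i ℕ.* mono i j a b) (j ℕ.* mono i j a b) (i ℕ.* mono i (suc j) a b) (j ℕ.* mono (suc (suc i)) (j ∸ 1) a b)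
    where
    regroup : ∀ w x y z → w ℕ.+ x ℕ.+ y ℕ.+ z ≡ (w ℕ.+ y) ℕ.+ (x ℕ.+ z)
    regroup = solve-∀

  *-pred-suc : ∀ i (h : ℕ → ℕ) → i ℕ.* h (i ∸ 1 ℕ.+ 1) ≡ i ℕ.* h i
  *-pred-suc zero    h = refl
  *-pred-suc (suc i) h = cong (λ k → suc i ℕ.* h k) (ℕ.+-comm i 1)

  coeff-Dmon : ∀ c i j a b → coeff (Dmon (c , i , j)) a b ≡ c * ℕtoℚ (DCoeffℕ (mono i j) a b)
  coeff-Dmon c i j a b = begin
    coeff (A₁ ∷ A₂ ∷ [] ++ B₁ ∷ B₂ ∷ []) a b
      ≡⟨ coeff-++ (A₁ ∷ A₂ ∷ []) (B₁ ∷ B₂ ∷ []) a b ⟩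
    coeff (A₁ ∷ A₂ ∷ []) a b + coeff (B₁ ∷ B₂ ∷ []) a b
      ≡⟨ cong₂ _+_ (trans (coeff-∷ x i₁ (j ℕ.+ 0) (A₂ ∷ []) a b) (cong (x * ℕtoℚ m₁ +_) (coeff-∷ x i₁ (j ℕ.+ 1) [] a b)))
                   (trans (coeff-∷ y (i ℕ.+ 0) j₁ (B₂ ∷ []) a b) (cong (y * ℕtoℚ m₃ +_) (coeff-∷ y (i ℕ.+ 2) (j ∸ 1 ℕ.+ 0) [] a b))) ⟩
    (x * ℕtoℚ m₁ + (x * ℕtoℚ m₂ + 0ℚ)) + (y * ℕtoℚ m₃ + (y * ℕtoℚ m₄ + 0ℚ))
      ≡⟨ solve 7 (λ c I J t₁ t₂ t₃ t₄ →
                   (c :* I :* con 1ℚ :* t₁ :+ (c :* I :* con 1ℚ :* t₂ :+ con 0ℚ))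
                     :+ (c :* J :* con 1ℚ :* t₃ :+ (c :* J :* con 1ℚ :* t₄ :+ con 0ℚ))
                   := c :* ((I :* t₁ :+ I :* t₂) :+ (J :* t₃ :+ J :* t₄)))
               refl c (ℕtoℚ i) (ℕtoℚ j) (ℕtoℚ m₁) (ℕtoℚ m₂) (ℕtoℚ m₃) (ℕtoℚ m₄) ⟩
    c * ((ℕtoℚ i * ℕtoℚ m₁ + ℕtoℚ i * ℕtoℚ m₂) + (ℕtoℚ j * ℕtoℚ m₃ + ℕtoℚ j * ℕtoℚ m₄))
      ≡⟨ cong (c *_) (sym ℕtoℚ-sum) ⟩
    c * ℕtoℚ ((i ℕ.* m₁ ℕ.+ i ℕ.* m₂) ℕ.+ (j ℕ.* m₃ ℕ.+ j ℕ.* m₄))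
      ≡⟨ cong (λ n → c * ℕtoℚ n) (trans normalise-indices (sym (DCoeffℕ-mono i j a b))) ⟩
    c * ℕtoℚ (DCoeffℕ (mono i j) a b) ∎
    where
    open +-*-Solver
    x = c * ℕtoℚ i * 1ℚ
    y = c * ℕtoℚ j * 1ℚ
    i₁ = i ∸ 1 ℕ.+ 1
    j₁ = j ∸ 1 ℕ.+ 1
    A₁ = (x , i₁ , j ℕ.+ 0)
    A₂ = (x , i₁ , j ℕ.+ 1)
    B₁ = (y , i ℕ.+ 0 , j₁)
    B₂ = (y , i ℕ.+ 2 , j ∸ 1 ℕ.+ 0)
    m₁ = mono i₁ (j ℕ.+ 0) a b
    m₂ = mono i₁ (j ℕ.+ 1) a b
    m₃ = mono (i ℕ.+ 0) j₁ a b
    m₄ = mono (i ℕ.+ 2) (j ∸ 1 ℕ.+ 0) a b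

    ℕtoℚ-sum : ℕtoℚ ((i ℕ.* m₁ ℕ.+ i ℕ.* m₂) ℕ.+ (j ℕ.* m₃ ℕ.+ j ℕ.* m₄))
             ≡ (ℕtoℚ i * ℕtoℚ m₁ + ℕtoℚ i * ℕtoℚ m₂) + (ℕtoℚ j * ℕtoℚ m₃ + ℕtoℚ j * ℕtoℚ m₄)
    ℕtoℚ-sum = trans (ℕtoℚ-+ (i ℕ.* m₁ ℕ.+ i ℕ.* m₂) (j ℕ.* m₃ ℕ.+ j ℕ.* m₄))
      (cong₂ _+_ (trans (ℕtoℚ-+ (i ℕ.* m₁) (i ℕ.* m₂)) (cong₂ _+_ (ℕtoℚ-* i m₁) (ℕtoℚ-* i m₂)))
                 (trans (ℕtoℚ-+ (j ℕ.* m₃) (j ℕ.* m₄)) (cong₂ _+_ (ℕtoℚ-* j m₃) (ℕtoℚ-* j m₄))))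

    normalise-indices : (i ℕ.* m₁ ℕ.+ i ℕ.* m₂) ℕ.+ (j ℕ.* m₃ ℕ.+ j ℕ.* m₄)
                      ≡ (i ℕ.* mono i j a b ℕ.+ i ℕ.* mono i (suc j) a b) ℕ.+ (j ℕ.* mono i j a b ℕ.+ j ℕ.* mono (suc (suc i)) (j ∸ 1) a b)
    normalise-indices = cong₂ ℕ._+_
      (cong₂ ℕ._+_ (trans (*-pred-suc i (λ k → mono k (j ℕ.+ 0) a b)) (cong (λ l → i ℕ.* mono i l a b) (ℕ.+-identityʳ j)))
                   (trans (*-pred-suc i (λ k → mono k (j ℕ.+ 1) a b)) (cong (λ l → i ℕ.* mono i l a b) (ℕ.+-comm j 1))))
      (cong₂ ℕ._+_ (trans (*-pred-suc j (λ l → mono (i ℕ.+ 0) l a b)) (cong (λ k → j ℕ.* mono k j a b) (ℕ.+-identityʳ i)))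
                   (cong₂ (λ k l → j ℕ.* mono k l a b) (ℕ.+-comm i 2) (ℕ.+-identityʳ (j ∸ 1))))

  DCoeff-linear : ∀ c g h a b → DCoeff (λ a b → c * g a b + h a b) a b ≡ c * DCoeff g a b + DCoeff h a b
  DCoeff-linear c g h a b = begin
    DCoeff (λ a b → c * g a b + h a b) a b
      ≡⟨ cong₂ _+_ (cong (λ r → ℕtoℚ (a ℕ.+ b) * (c * g a b + h a b) + ℕtoℚ a * r) (yShift-linear a b))
                   (cong (ℕtoℚ (suc b) *_) (x²y⁻¹Shift-linear a b)) ⟩
    ℕtoℚ (a ℕ.+ b) * (c * g a b + h a b) + ℕtoℚ a * (c * yShift 0ℚ g a b + yShift 0ℚ h a b)
      + ℕtoℚ (suc b) * (c * x²y⁻¹Shift 0ℚ g a b + x²y⁻¹Shift 0ℚ h a b)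
      ≡⟨ solve 10 (λ m n k c x x′ y y′ z z′ →
                    m :* (c :* x :+ x′) :+ n :* (c :* y :+ y′) :+ k :* (c :* z :+ z′)
                    := c :* (m :* x :+ n :* y :+ k :* z) :+ (m :* x′ :+ n :* y′ :+ k :* z′))
               refl (ℕtoℚ (a ℕ.+ b)) (ℕtoℚ a) (ℕtoℚ (suc b)) c (g a b) (h a b)
               (yShift 0ℚ g a b) (yShift 0ℚ h a b) (x²y⁻¹Shift 0ℚ g a b) (x²y⁻¹Shift 0ℚ h a b) ⟩
    c * DCoeff g a b + DCoeff h a b ∎
    where
    open +-*-Solver
    0≡c*0+0 : 0ℚ ≡ c * 0ℚ + 0ℚ
    0≡c*0+0 = sym (trans (ℚ.+-identityʳ (c * 0ℚ)) (ℚ.*-zeroʳ c))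

    yShift-linear : ∀ a b → yShift 0ℚ (λ a b → c * g a b + h a b) a b ≡ c * yShift 0ℚ g a b + yShift 0ℚ h a b
    yShift-linear a zero    = 0≡c*0+0
    yShift-linear a (suc b) = refl

    x²y⁻¹Shift-linear : ∀ a b → x²y⁻¹Shift 0ℚ (λ a b → c * g a b + h a b) a b ≡ c * x²y⁻¹Shift 0ℚ g a b + x²y⁻¹Shift 0ℚ h a b
    x²y⁻¹Shift-linear zero          b = 0≡c*0+0
    x²y⁻¹Shift-linear (suc zero)    b = 0≡c*0+0
    x²y⁻¹Shift-linear (suc (suc a)) b = refl

  DCoeff-x⁰ : ∀ g → (∀ b → g 0 b ≡ 0ℚ) → ∀ b → DCoeff g 0 b ≡ 0ℚ
  DCoeff-x⁰ g g₀≡0 b = begin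
    ℕtoℚ b * g 0 b + 0ℚ * yShift 0ℚ g 0 b + ℕtoℚ (suc b) * 0ℚ
      ≡⟨ cong₂ _+_ (cong₂ _+_ (trans (cong (ℕtoℚ b *_) (g₀≡0 b)) (ℚ.*-zeroʳ (ℕtoℚ b))) (ℚ.*-zeroˡ (yShift 0ℚ g 0 b)))
                   (ℚ.*-zeroʳ (ℕtoℚ (suc b))) ⟩
    0ℚ ∎

  DCoeff-zero : ∀ a b → DCoeff (λ _ _ → 0ℚ) a b ≡ 0ℚ
  DCoeff-zero a b = begin
    DCoeff (λ _ _ → 0ℚ) a b
      ≡⟨ cong₂ _+_ (cong (λ r → ℕtoℚ (a ℕ.+ b) * 0ℚ + ℕtoℚ a * r) (sym (yShift-map {z = 0ℚ} (λ _ → 0ℚ) refl (λ _ _ → 0ℚ) a b)))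
                   (cong (ℕtoℚ (suc b) *_) (sym (x²y⁻¹Shift-map {z = 0ℚ} (λ _ → 0ℚ) refl (λ _ _ → 0ℚ) a b))) ⟩
    ℕtoℚ (a ℕ.+ b) * 0ℚ + ℕtoℚ a * 0ℚ + ℕtoℚ (suc b) * 0ℚ
      ≡⟨ solve 3 (λ m n k → m :* con 0ℚ :+ n :* con 0ℚ :+ k :* con 0ℚ := con 0ℚ) refl (ℕtoℚ (a ℕ.+ b)) (ℕtoℚ a) (ℕtoℚ (suc b)) ⟩
    0ℚ ∎
    where open +-*-Solver

  coeff-D : ∀ f a b → coeff (D f) a b ≡ DCoeff (coeff f) a b
  coeff-D [] a b = sym (DCoeff-zero a b)
  coeff-D ((c , i , j) ∷ f) a b = begin
    coeff (Dmon (c , i , j) ++ D f) a b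
      ≡⟨ coeff-++ (Dmon (c , i , j)) (D f) a b ⟩
    coeff (Dmon (c , i , j)) a b + coeff (D f) a b
      ≡⟨ cong₂ _+_ (trans (coeff-Dmon c i j a b) (cong (c *_) (ℕtoℚ-DCoeffℕ (mono i j) a b))) (coeff-D f a b) ⟩
    c * DCoeff (λ a b → ℕtoℚ (mono i j a b)) a b + DCoeff (coeff f) a b
      ≡⟨ DCoeff-linear c (λ a b → ℕtoℚ (mono i j a b)) (coeff f) a b ⟨
    DCoeff (λ a b → c * ℕtoℚ (mono i j a b) + coeff f a b) a b
      ≡⟨ DCoeff-cong (λ a b → sym (coeff-∷ c i j f a b)) a b ⟩
    DCoeff (coeff ((c , i , j) ∷ f)) a b ∎

  coeff-Dpow-x⁰ : ∀ n b → coeff (Dpow n xPoly) 0 b ≡ 0ℚ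
  coeff-Dpow-x⁰ zero    b = refl
  coeff-Dpow-x⁰ (suc n) b = trans (coeff-D (Dpow n xPoly) 0 b) (DCoeff-x⁰ _ (coeff-Dpow-x⁰ n) b)

  b≡coeff : ∀ n i j → b n i j ≡ coeff (Dpow n xPoly) i j
  b≡coeff n zero    j = sym (coeff-Dpow-x⁰ n j)
  b≡coeff n (suc i) j = refl

  b-suc : ∀ n i j → b (suc n) i j ≡ DCoeff (b n) i j
  b-suc n i j = begin
    b (suc n) i j                        ≡⟨ b≡coeff (suc n) i j ⟩
    coeff (D (Dpow n xPoly)) i j         ≡⟨ coeff-D (Dpow n xPoly) i j ⟩
    DCoeff (coeff (Dpow n xPoly)) i j    ≡⟨ DCoeff-cong (λ a b → sym (b≡coeff n a b)) i j ⟩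
    DCoeff (b n) i j                     ∎

  bℕ : ℕ → ℕ → ℕ → ℕ
  bℕ zero    (suc zero) zero = 1
  bℕ zero    _          _    = 0
  bℕ (suc n) i          j    = DCoeffℕ (bℕ n) i j

  b≡bℕ : ∀ n i j → b n i j ≡ ℕtoℚ (bℕ n i j)
  b≡bℕ zero    zero                j       = refl
  b≡bℕ zero    (suc zero)          zero    = refl
  b≡bℕ zero    (suc zero)          (suc j) = refl
  b≡bℕ zero    (suc (suc i))       j       = refl
  b≡bℕ (suc n) i j = begin
    b (suc n) i j                                ≡⟨ b-suc n i j ⟩
    DCoeff (b n) i j                             ≡⟨ DCoeff-cong (b≡bℕ n) i j ⟩
    DCoeff (λ a b → ℕtoℚ (bℕ n a b)) i j         ≡⟨ ℕtoℚ-DCoeffℕ (bℕ n) i j ⟨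
    ℕtoℚ (bℕ (suc n) i j)                        ∎

module StirlingFactorisation where

  open import Data.Nat as ℕ using (ℕ; zero; suc; _+_; _*_)
  import Data.Nat.Properties as ℕ
  open import Data.Nat.Tactic.RingSolver using (solve-∀)
  open import Relation.Binary.PropositionalEquality
  open ≡-Reasoning
  open import Defs using (S)
  open CoefficientsOfD using (yShift; x²y⁻¹Shift; bℕ)

  cofactor : ℕ → ℕ → ℕ → ℕ
  cofactor zero    (suc zero) zero = 1
  cofactor zero    _          _    = 0
  cofactor (suc m) a          b    = a * yShift 0 (cofactor m) a b + suc b * x²y⁻¹Shift 0 (cofactor m) a b

  bℕ≡S*cofactor : ∀ n m a b → a + b ≡ suc m → bℕ n a b ≡ S (suc n) (suc m) * cofactor m a b
  bℕ≡S*cofactor zero zero (suc zero) zero          _ = refl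
  bℕ≡S*cofactor zero zero zero       (suc zero)    _ = refl
  bℕ≡S*cofactor zero zero zero       (suc (suc b)) ()
  bℕ≡S*cofactor zero zero (suc zero) (suc b)       e with ℕ.suc-injective e
  ... | ()
  bℕ≡S*cofactor zero zero (suc (suc a)) b ()
  bℕ≡S*cofactor zero (suc m) zero          (suc b) _ rewrite ℕ.*-zeroʳ m = refl
  bℕ≡S*cofactor zero (suc m) (suc zero)    zero    ()
  bℕ≡S*cofactor zero (suc m) (suc zero)    (suc b) _ rewrite ℕ.*-zeroʳ m = refl
  bℕ≡S*cofactor zero (suc m) (suc (suc a)) b       _ rewrite ℕ.*-zeroʳ m = refl
  bℕ≡S*cofactor (suc n) zero (suc zero) zero _ =
    trans (cong (λ s → 1 * s + 1 * 0 + 1 * 0) (bℕ≡S*cofactor n zero 1 0 refl)) (simplify (S (suc n) 1))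
    where
    simplify : ∀ s → 1 * (s * 1) + 1 * 0 + 1 * 0 ≡ (1 * s + 0) * 1
    simplify = solve-∀
  bℕ≡S*cofactor (suc n) zero zero (suc zero) _ =
    trans (cong (λ s → 1 * s + 0 * 0 + 2 * 0) (bℕ≡S*cofactor n zero 0 1 refl)) (simplify (S (suc n) 1))
    where
    simplify : ∀ s → 1 * (s * 0) + 0 * 0 + 2 * 0 ≡ (1 * s + 0) * 0
    simplify = solve-∀
  bℕ≡S*cofactor (suc n) zero zero (suc (suc b)) ()
  bℕ≡S*cofactor (suc n) zero (suc zero) (suc b) e with ℕ.suc-injective e
  ... | ()
  bℕ≡S*cofactor (suc n) zero (suc (suc a)) b ()
  bℕ≡S*cofactor (suc n) (suc m) a b a+b≡2+m = begin
    (a + b) * bℕ n a b + a * yShift 0 (bℕ n) a b + suc b * x²y⁻¹Shift 0 (bℕ n) a b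
      ≡⟨ cong₂ _+_ (cong₂ _+_ (cong₂ _*_ a+b≡2+m (bℕ≡S*cofactor n (suc m) a b a+b≡2+m))
                              (cong (a *_) (yShift-factor a b a+b≡2+m)))
                   (cong (suc b *_) (x²y⁻¹Shift-factor a b a+b≡2+m)) ⟩
    suc (suc m) * (S (suc n) (suc (suc m)) * cofactor (suc m) a b)
      + a * (S (suc n) (suc m) * yShift 0 (cofactor m) a b) + suc b * (S (suc n) (suc m) * x²y⁻¹Shift 0 (cofactor m) a b)
      ≡⟨ factor (suc (suc m)) (S (suc n) (suc (suc m))) (S (suc n) (suc m)) a (suc b)
                (yShift 0 (cofactor m) a b) (x²y⁻¹Shift 0 (cofactor m) a b) ⟩
    (suc (suc m) * S (suc n) (suc (suc m)) + S (suc n) (suc m)) * cofactor (suc m) a b ∎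
    where
    factor : ∀ k s s′ a b′ y z → k * (s * (a * y + b′ * z)) + a * (s′ * y) + b′ * (s′ * z) ≡ (k * s + s′) * (a * y + b′ * z)
    factor = solve-∀

    yShift-factor : ∀ a b → a + b ≡ suc (suc m) → yShift 0 (bℕ n) a b ≡ S (suc n) (suc m) * yShift 0 (cofactor m) a b
    yShift-factor a zero    _ = sym (ℕ.*-zeroʳ (S (suc n) (suc m)))
    yShift-factor a (suc b) e = bℕ≡S*cofactor n m a b (ℕ.suc-injective (trans (sym (ℕ.+-suc a b)) e))

    x²y⁻¹Shift-factor : ∀ a b → a + b ≡ suc (suc m) → x²y⁻¹Shift 0 (bℕ n) a b ≡ S (suc n) (suc m) * x²y⁻¹Shift 0 (cofactor m) a b
    x²y⁻¹Shift-factor zero          b _ = sym (ℕ.*-zeroʳ (S (suc n) (suc m)))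
    x²y⁻¹Shift-factor (suc zero)    b _ = sym (ℕ.*-zeroʳ (S (suc n) (suc m)))
    x²y⁻¹Shift-factor (suc (suc a)) b e =
      bℕ≡S*cofactor n m a (suc b) (trans (ℕ.+-suc a b) (cong suc (ℕ.suc-injective (ℕ.suc-injective e))))

module Permutations where

  open import Data.Nat using (ℕ)
  open import Data.List using (List; []; _∷_; _++_; map; concatMap; [_])
  import Data.List.Properties as List
  open import Data.List.Relation.Binary.Permutation.Propositional
  open import Data.List.Relation.Binary.Permutation.Propositional.Properties
  open import Relation.Binary.PropositionalEquality as ≡ using (_≡_)
  open import Defs using (insertEverywhere; perms)

  concatMap-cong-↭ : ∀ {A B : Set} {f g : A → List B} → (∀ x → f x ↭ g x) → ∀ xs → concatMap f xs ↭ concatMap g xs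
  concatMap-cong-↭ f↭g []       = ↭-refl
  concatMap-cong-↭ f↭g (x ∷ xs) = ++⁺ (f↭g x) (concatMap-cong-↭ f↭g xs)

  concatMap⁺ : ∀ {A B : Set} (f : A → List B) {xs ys} → xs ↭ ys → concatMap f xs ↭ concatMap f ys
  concatMap⁺ f refl         = ↭-refl
  concatMap⁺ f (prep x p)   = ++⁺ˡ (f x) (concatMap⁺ f p)
  concatMap⁺ f (swap {xs} x y p) =
    ↭-trans (shifts (f x) (f y) {concatMap f xs}) (++⁺ˡ (f y) (++⁺ˡ (f x) (concatMap⁺ f p)))
  concatMap⁺ f (trans p q)  = ↭-trans (concatMap⁺ f p) (concatMap⁺ f q)

  concatMap-concatMap : ∀ {A B C : Set} (f : B → List C) (g : A → List B) xs →
                        concatMap f (concatMap g xs) ≡ concatMap (λ x → concatMap f (g x)) xs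
  concatMap-concatMap f g []       = ≡.refl
  concatMap-concatMap f g (x ∷ xs) =
    ≡.trans (List.concatMap-++ f (g x) _) (≡.cong (concatMap f (g x) ++_) (concatMap-concatMap f g xs))

  private
    insert-under-head : ∀ (x z : ℕ) us →
      concatMap (λ u → insertEverywhere x (z ∷ u)) us ↭ map (λ u → x ∷ z ∷ u) us ++ map (z ∷_) (concatMap (insertEverywhere x) us)
    insert-under-head x z []       = ↭-refl
    insert-under-head x z (u ∷ us) = prep (x ∷ z ∷ u)
      (↭-trans (++⁺ˡ (map (z ∷_) (insertEverywhere x u)) (insert-under-head x z us))
      (↭-trans (shifts (map (z ∷_) (insertEverywhere x u)) (map (λ u → x ∷ z ∷ u) us))
               (++⁺ˡ (map (λ u → x ∷ z ∷ u) us)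
                     (↭-reflexive (≡.sym (List.map-++ (z ∷_) (insertEverywhere x u) (concatMap (insertEverywhere x) us)))))))

  insertEverywhere-comm : ∀ (x y : ℕ) w →
    concatMap (insertEverywhere x) (insertEverywhere y w) ↭ concatMap (insertEverywhere y) (insertEverywhere x w)
  insertEverywhere-comm x y []      = swap (x ∷ y ∷ []) (y ∷ x ∷ []) ↭-refl
  insertEverywhere-comm x y (z ∷ w) =
    ↭-trans (expand x y) (↭-trans (swap _ _ middle) (↭-sym (expand y x)))
    where
    expand : ∀ x y → concatMap (insertEverywhere x) (insertEverywhere y (z ∷ w)) ↭
      (x ∷ y ∷ z ∷ w) ∷ (y ∷ x ∷ z ∷ w) ∷ (map (λ u → y ∷ z ∷ u) (insertEverywhere x w)
        ++ (map (λ u → x ∷ z ∷ u) (insertEverywhere y w) ++ map (z ∷_) (concatMap (insertEverywhere x) (insertEverywhere y w))))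
    expand x y = prep _ (prep _ (++⁺ (↭-reflexive (≡.sym (List.map-∘ (insertEverywhere x w))))
      (↭-trans (↭-reflexive (List.concatMap-map (insertEverywhere x) (z ∷_) (insertEverywhere y w)))
               (insert-under-head x z (insertEverywhere y w)))))

    middle : map (λ u → y ∷ z ∷ u) (insertEverywhere x w)
               ++ (map (λ u → x ∷ z ∷ u) (insertEverywhere y w) ++ map (z ∷_) (concatMap (insertEverywhere x) (insertEverywhere y w)))
           ↭ map (λ u → x ∷ z ∷ u) (insertEverywhere y w)
               ++ (map (λ u → y ∷ z ∷ u) (insertEverywhere x w) ++ map (z ∷_) (concatMap (insertEverywhere y) (insertEverywhere x w)))
    middle = ↭-trans (shifts (map (λ u → y ∷ z ∷ u) (insertEverywhere x w)) (map (λ u → x ∷ z ∷ u) (insertEverywhere y w)))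
                     (++⁺ˡ (map (λ u → x ∷ z ∷ u) (insertEverywhere y w))
                           (++⁺ˡ (map (λ u → y ∷ z ∷ u) (insertEverywhere x w)) (map⁺ (z ∷_) (insertEverywhere-comm x y w))))

  perms-∷ʳ : ∀ xs (y : ℕ) → perms (xs ++ [ y ]) ↭ concatMap (insertEverywhere y) (perms xs)
  perms-∷ʳ []       y = ↭-refl
  perms-∷ʳ (x ∷ xs) y =
    ↭-trans (concatMap⁺ (insertEverywhere x) (perms-∷ʳ xs y))
    (↭-trans (↭-reflexive (concatMap-concatMap (insertEverywhere x) (insertEverywhere y) (perms xs)))
    (↭-trans (concatMap-cong-↭ (insertEverywhere-comm x y) (perms xs))
             (↭-reflexive (≡.sym (concatMap-concatMap (insertEverywhere y) (insertEverywhere x) (perms xs))))))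

module LeftPeaks where

  open import Data.Nat as ℕ using (ℕ; zero; suc; _∸_; _+_; _*_; _<_; _≤_; s≤s; z≤n; _<ᵇ_; _≡ᵇ_)
  import Data.Nat.Properties as ℕ
  open import Data.Nat.Tactic.RingSolver using (solve-∀)
  open import Data.Bool using (Bool; true; false; _∧_; T; if_then_else_)
  open import Data.Bool.Properties using (∧-zeroʳ)
  open import Data.Empty using (⊥-elim)
  open import Data.List using (List; []; _∷_; _++_; map; concatMap; length; filter)
  import Data.List.Properties as List
  open import Data.List.Relation.Unary.All as All using (All; []; _∷_)
  import Data.List.Relation.Unary.All.Properties as All
  open import Data.List.Relation.Binary.Permutation.Propositional.Properties using (filter-↭; ↭-length)
  open import Data.Product using (_×_; _,_)
  open import Relation.Binary.PropositionalEquality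
  open ≡-Reasoning
  open import Defs using (insertEverywhere; perms; oneTo; peaksAux; leftPeaks; P)
  open KroneckerDelta
  open Permutations using (perms-∷ʳ)

  sumMap : {A : Set} → (A → ℕ) → List A → ℕ
  sumMap f []       = 0
  sumMap f (x ∷ xs) = f x + sumMap f xs

  sumMap-map : ∀ {A B : Set} (f : B → ℕ) (h : A → B) xs → sumMap f (map h xs) ≡ sumMap (λ x → f (h x)) xs
  sumMap-map f h []       = refl
  sumMap-map f h (x ∷ xs) = cong (f (h x) +_) (sumMap-map f h xs)

  sumMap-cong : ∀ {A : Set} {f g : A → ℕ} → (∀ x → f x ≡ g x) → ∀ xs → sumMap f xs ≡ sumMap g xs
  sumMap-cong f≗g []       = refl
  sumMap-cong f≗g (x ∷ xs) = cong₂ _+_ (f≗g x) (sumMap-cong f≗g xs)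

  sumMap-cong-All : ∀ {A : Set} {f g : A → ℕ} {xs} → All (λ x → f x ≡ g x) xs → sumMap f xs ≡ sumMap g xs
  sumMap-cong-All []         = refl
  sumMap-cong-All (fx≡gx ∷ p) = cong₂ _+_ fx≡gx (sumMap-cong-All p)

  sumMap-++ : ∀ {A : Set} (f : A → ℕ) xs ys → sumMap f (xs ++ ys) ≡ sumMap f xs + sumMap f ys
  sumMap-++ f []       ys = refl
  sumMap-++ f (x ∷ xs) ys = trans (cong (f x +_) (sumMap-++ f xs ys)) (sym (ℕ.+-assoc (f x) _ _))

  sumMap-concatMap : ∀ {A B : Set} (f : B → ℕ) (g : A → List B) xs →
                     sumMap f (concatMap g xs) ≡ sumMap (λ x → sumMap f (g x)) xs
  sumMap-concatMap f g []       = refl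
  sumMap-concatMap f g (x ∷ xs) = trans (sumMap-++ f (g x) (concatMap g xs)) (cong (sumMap f (g x) +_) (sumMap-concatMap f g xs))

  sumMap-+ : ∀ {A : Set} (f g : A → ℕ) xs → sumMap (λ x → f x + g x) xs ≡ sumMap f xs + sumMap g xs
  sumMap-+ f g []       = refl
  sumMap-+ f g (x ∷ xs) rewrite sumMap-+ f g xs = interchange (f x) (g x) (sumMap f xs) (sumMap g xs)
    where
    interchange : ∀ a b c d → a + b + (c + d) ≡ a + c + (b + d)
    interchange = solve-∀

  sumMap-* : ∀ {A : Set} (c : ℕ) (f : A → ℕ) xs → sumMap (λ x → c * f x) xs ≡ c * sumMap f xs
  sumMap-* c f []       = sym (ℕ.*-zeroʳ c)
  sumMap-* c f (x ∷ xs) rewrite sumMap-* c f xs = sym (ℕ.*-distribˡ-+ c (f x) (sumMap f xs))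

  length-filter : ∀ {A : Set} (f : A → ℕ) k xs → length (filter (λ x → f x ℕ.≟ k) xs) ≡ sumMap (λ x → δ (f x) k) xs
  length-filter f k []       = refl
  length-filter f k (x ∷ xs) with f x ≡ᵇ k
  ... | true  = cong suc (length-filter f k xs)
  ... | false = length-filter f k xs

  <⇒<ᵇ≡true : ∀ {m n} → m < n → (m <ᵇ n) ≡ true
  <⇒<ᵇ≡true {m} {n} m<n with m <ᵇ n | ℕ.<⇒<ᵇ m<n
  ... | true | _ = refl

  >⇒<ᵇ≡false : ∀ {m n} → n < m → (m <ᵇ n) ≡ false
  >⇒<ᵇ≡false {m} {n} n<m with m <ᵇ n in m<ᵇn
  ... | false = refl
  ... | true  = ⊥-elim (ℕ.<-asym n<m (ℕ.<ᵇ⇒< m n (subst T (sym m<ᵇn) _)))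

  <ᵇ≡true⇒< : ∀ {m n} → (m <ᵇ n) ≡ true → m < n
  <ᵇ≡true⇒< {m} {n} m<ᵇn = ℕ.<ᵇ⇒< m n (subst T (sym m<ᵇn) _)

  ∧≡true⇒ʳ : ∀ b {b′} → (b ∧ b′) ≡ true → b′ ≡ true
  ∧≡true⇒ʳ true b′≡true = b′≡true

  2*suc : ∀ n → 2 * suc n ≡ suc (suc (2 * n))
  2*suc = solve-∀

  peaksAux-descent : ∀ {c d} w → d < c → peaksAux (c ∷ d ∷ w) ≡ peaksAux (d ∷ w)
  peaksAux-descent         []      _   = refl
  peaksAux-descent {c} {d} (_ ∷ w) d<c rewrite >⇒<ᵇ≡false {c} {d} d<c = refl

  2*peaksAux≤length : ∀ a w → 2 * peaksAux (a ∷ w) ≤ length w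
  2*peaksAux≤length a []          = z≤n
  2*peaksAux≤length a (c ∷ [])    = z≤n
  2*peaksAux≤length a (c ∷ d ∷ w) = extend (2*peaksAux≤length c (d ∷ w)) (2*peaksAux≤length d w)
    where
    extend : 2 * peaksAux (c ∷ d ∷ w) ≤ suc (length w) → 2 * peaksAux (d ∷ w) ≤ length w →
             2 * peaksAux (a ∷ c ∷ d ∷ w) ≤ suc (suc (length w))
    extend bound-c bound-d with (a <ᵇ c) ∧ (d <ᵇ c) in c-peak
    ... | false = ℕ.m≤n⇒m≤1+n bound-c
    ... | true  = ℕ.≤-trans (ℕ.≤-reflexive 2*peaks≡) (s≤s (s≤s bound-d))
      where
      2*peaks≡ : 2 * suc (peaksAux (c ∷ d ∷ w)) ≡ suc (suc (2 * peaksAux (d ∷ w)))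
      2*peaks≡ = trans (cong (λ k → 2 * suc k) (peaksAux-descent w (<ᵇ≡true⇒< (∧≡true⇒ʳ (a <ᵇ c) c-peak))))
                       (2*suc (peaksAux (d ∷ w)))

  -- Of the length w + 1 places for a new maximum M, the 2K + 1 places next to one of the K peaks or at
  -- the end leave the number of peaks unchanged; every other place creates one new peak.
  module MaximumInsertion (M : ℕ) where

    insertionSum : (ℕ → ℕ) → ℕ → List ℕ → ℕ
    insertionSum g a w = sumMap (λ v → g (peaksAux (a ∷ v))) (insertEverywhere M w)

    insertionCount : (ℕ → ℕ) → ℕ → List ℕ → ℕ
    insertionCount g a w = suc (2 * K) * g K + (length w ∸ 2 * K) * g (suc K)
      where K = peaksAux (a ∷ w)

    private
      peaks-M-peak : ∀ {c d} w → c < M → d < M → peaksAux (c ∷ M ∷ d ∷ w) ≡ suc (peaksAux (d ∷ w))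
      peaks-M-peak {c} {d} w c<M d<M rewrite <⇒<ᵇ≡true c<M | <⇒<ᵇ≡true d<M = cong suc (peaksAux-descent w d<M)

      insertionSum-∷ : ∀ g {c d} w → c < M → d < M →
        insertionSum g c (d ∷ w) ≡ g (suc (peaksAux (d ∷ w))) + sumMap (λ u → g (peaksAux (c ∷ d ∷ u))) (insertEverywhere M w)
      insertionSum-∷ g {c} {d} w c<M d<M =
        cong₂ _+_ (cong g (peaks-M-peak w c<M d<M)) (sumMap-map (λ v → g (peaksAux (c ∷ v))) (d ∷_) (insertEverywhere M w))

      insertionSum-∷∷ : ∀ g {a c d} w → a < M → c < M → d < M →
        insertionSum g a (c ∷ d ∷ w) ≡ g (suc (peaksAux (c ∷ d ∷ w)))
          + (g (suc (peaksAux (d ∷ w))) + sumMap (λ u → g (peaksAux (a ∷ c ∷ d ∷ u))) (insertEverywhere M w))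
      insertionSum-∷∷ g {a} {c} {d} w a<M c<M d<M = cong₂ _+_
        (cong g (peaks-M-peak (d ∷ w) a<M c<M))
        (cong₂ _+_ (cong g M-not-after-c)
          (trans (sumMap-map (λ v → g (peaksAux (a ∷ v))) (c ∷_) (map (d ∷_) (insertEverywhere M w)))
                 (sumMap-map (λ v → g (peaksAux (a ∷ c ∷ v))) (d ∷_) (insertEverywhere M w))))
        where
        M-not-after-c : peaksAux (a ∷ c ∷ M ∷ d ∷ w) ≡ suc (peaksAux (d ∷ w))
        M-not-after-c rewrite >⇒<ᵇ≡false {M} {c} c<M | ∧-zeroʳ (a <ᵇ c) = peaks-M-peak w c<M d<M

      peaks-prefix : ∀ a c d → ((a <ᵇ c) ∧ (d <ᵇ c)) ≡ true → ∀ u → peaksAux (a ∷ c ∷ d ∷ u) ≡ suc (peaksAux (c ∷ d ∷ u))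
      peaks-prefix a c d c-peak u = cong (λ b → (if b then 1 else 0) + peaksAux (c ∷ d ∷ u)) c-peak

      no-peaks-prefix : ∀ a c d → ((a <ᵇ c) ∧ (d <ᵇ c)) ≡ false → ∀ u → peaksAux (a ∷ c ∷ d ∷ u) ≡ peaksAux (c ∷ d ∷ u)
      no-peaks-prefix a c d no-c-peak u = cong (λ b → (if b then 1 else 0) + peaksAux (c ∷ d ∷ u)) no-c-peak

    private
      no-new-peak : ∀ g {a c d} w → a < M → c < M → d < M → ((a <ᵇ c) ∧ (d <ᵇ c)) ≡ false →
        insertionSum g c (d ∷ w) ≡ insertionCount g c (d ∷ w) → 2 * peaksAux (c ∷ d ∷ w) ≤ suc (length w) →
        let K′ = peaksAux (c ∷ d ∷ w) in
        insertionSum g a (c ∷ d ∷ w) ≡ suc (2 * K′) * g K′ + (suc (suc (length w)) ∸ 2 * K′) * g (suc K′)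
      no-new-peak g {a} {c} {d} w a<M c<M d<M no-c-peak IH bound = begin
        insertionSum g a (c ∷ d ∷ w)
          ≡⟨ insertionSum-∷∷ g w a<M c<M d<M ⟩
        g (suc K′) + (g (suc κ) + sumMap (λ u → g (peaksAux (a ∷ c ∷ d ∷ u))) (insertEverywhere M w))
          ≡⟨ cong (λ r → g (suc K′) + (g (suc κ) + r)) (sumMap-cong (λ u → cong g (no-peaks-prefix a c d no-c-peak u)) (insertEverywhere M w)) ⟩
        g (suc K′) + (g (suc κ) + sumMap (λ u → g (peaksAux (c ∷ d ∷ u))) (insertEverywhere M w))
          ≡⟨ cong (g (suc K′) +_) (trans (sym (insertionSum-∷ g w c<M d<M)) IH) ⟩
        g (suc K′) + (suc (2 * K′) * g K′ + (suc (length w) ∸ 2 * K′) * g (suc K′))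
          ≡⟨ absorb (g (suc K′)) (suc (2 * K′) * g K′) (suc (length w) ∸ 2 * K′) ⟩
        suc (2 * K′) * g K′ + suc (suc (length w) ∸ 2 * K′) * g (suc K′)
          ≡⟨ cong (λ n → suc (2 * K′) * g K′ + n * g (suc K′)) (ℕ.+-∸-assoc 1 bound) ⟨
        suc (2 * K′) * g K′ + (suc (suc (length w)) ∸ 2 * K′) * g (suc K′) ∎
        where
        K′ = peaksAux (c ∷ d ∷ w)
        κ  = peaksAux (d ∷ w)
        absorb : ∀ x A B → x + (A + B * x) ≡ A + suc B * x
        absorb = solve-∀

      new-peak : ∀ g {a c d} w → a < M → c < M → d < M → ((a <ᵇ c) ∧ (d <ᵇ c)) ≡ true →
        insertionSum (λ k → g (suc k)) c (d ∷ w) ≡ insertionCount (λ k → g (suc k)) c (d ∷ w) →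
        2 * peaksAux (d ∷ w) ≤ length w →
        let K′ = peaksAux (c ∷ d ∷ w) in
        insertionSum g a (c ∷ d ∷ w) ≡ suc (2 * suc K′) * g (suc K′) + (suc (suc (length w)) ∸ 2 * suc K′) * g (suc (suc K′))
      new-peak g {a} {c} {d} w a<M c<M d<M c-peak IH-suc bound = begin
        insertionSum g a (c ∷ d ∷ w)
          ≡⟨ insertionSum-∷∷ g w a<M c<M d<M ⟩
        g (suc K′) + (g (suc κ) + sumMap (λ u → g (peaksAux (a ∷ c ∷ d ∷ u))) (insertEverywhere M w))
          ≡⟨ cong₂ (λ k r → g (suc k) + (g (suc κ) + r)) K′≡κ
                   (sumMap-cong (λ u → cong g (peaks-prefix a c d c-peak u)) (insertEverywhere M w)) ⟩
        g (suc κ) + (g (suc κ) + rest)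
          ≡⟨ ℕ.+-cancelˡ-≡ (g (suc (suc κ))) _ _ (count-both-sides (g (suc κ)) (g (suc (suc κ))) rest IH-suc′) ⟩
        suc (2 * suc κ) * g (suc κ) + (length w ∸ 2 * κ) * g (suc (suc κ))
          ≡⟨ cong (λ n → suc (2 * suc κ) * g (suc κ) + n * g (suc (suc κ))) (cong (suc (suc (length w)) ∸_) (2*suc κ)) ⟨
        suc (2 * suc κ) * g (suc κ) + (suc (suc (length w)) ∸ 2 * suc κ) * g (suc (suc κ))
          ≡⟨ cong (λ k → suc (2 * k) * g k + (suc (suc (length w)) ∸ 2 * k) * g (suc k)) (cong suc K′≡κ) ⟨
        suc (2 * suc K′) * g (suc K′) + (suc (suc (length w)) ∸ 2 * suc K′) * g (suc (suc K′)) ∎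
        where
        K′ = peaksAux (c ∷ d ∷ w)
        κ  = peaksAux (d ∷ w)
        rest = sumMap (λ u → g (suc (peaksAux (c ∷ d ∷ u)))) (insertEverywhere M w)

        K′≡κ : K′ ≡ κ
        K′≡κ = peaksAux-descent w (<ᵇ≡true⇒< (∧≡true⇒ʳ (a <ᵇ c) c-peak))

        IH-suc′ : g (suc (suc κ)) + rest ≡ suc (2 * κ) * g (suc κ) + suc (length w ∸ 2 * κ) * g (suc (suc κ))
        IH-suc′ = begin
          g (suc (suc κ)) + rest
            ≡⟨ insertionSum-∷ (λ k → g (suc k)) w c<M d<M ⟨
          insertionSum (λ k → g (suc k)) c (d ∷ w)
            ≡⟨ IH-suc ⟩
          suc (2 * K′) * g (suc K′) + (suc (length w) ∸ 2 * K′) * g (suc (suc K′))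
            ≡⟨ cong (λ k → suc (2 * k) * g (suc k) + (suc (length w) ∸ 2 * k) * g (suc (suc k))) K′≡κ ⟩
          suc (2 * κ) * g (suc κ) + (suc (length w) ∸ 2 * κ) * g (suc (suc κ))
            ≡⟨ cong (λ n → suc (2 * κ) * g (suc κ) + n * g (suc (suc κ))) (ℕ.+-∸-assoc 1 bound) ⟩
          suc (2 * κ) * g (suc κ) + suc (length w ∸ 2 * κ) * g (suc (suc κ)) ∎

        count-both-sides : ∀ x y T → y + T ≡ suc (2 * κ) * x + suc (length w ∸ 2 * κ) * y →
                           y + (x + (x + T)) ≡ y + (suc (2 * suc κ) * x + (length w ∸ 2 * κ) * y)
        count-both-sides x y T y+T≡ = begin
          y + (x + (x + T))                                       ≡⟨ move-y x y T ⟩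
          x + x + (y + T)                                         ≡⟨ cong (x + x +_) y+T≡ ⟩
          x + x + (suc (2 * κ) * x + suc (length w ∸ 2 * κ) * y)  ≡⟨ collect κ x y (length w ∸ 2 * κ) ⟩
          y + (suc (2 * suc κ) * x + (length w ∸ 2 * κ) * y)      ∎
          where
          move-y : ∀ x y T → y + (x + (x + T)) ≡ x + x + (y + T)
          move-y = solve-∀
          collect : ∀ k x y D → x + x + (suc (2 * k) * x + suc D * y) ≡ y + (suc (2 * suc k) * x + D * y)
          collect = solve-∀

      extend : ∀ g {a c d} w → a < M → c < M → d < M →
        insertionSum g c (d ∷ w) ≡ insertionCount g c (d ∷ w) →
        insertionSum (λ k → g (suc k)) c (d ∷ w) ≡ insertionCount (λ k → g (suc k)) c (d ∷ w) →
        insertionSum g a (c ∷ d ∷ w) ≡ insertionCount g a (c ∷ d ∷ w)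
      extend g {a} {c} {d} w a<M c<M d<M IH IH-suc with (a <ᵇ c) ∧ (d <ᵇ c) in c-peak
      ... | false = no-new-peak g w a<M c<M d<M c-peak IH (2*peaksAux≤length c (d ∷ w))
      ... | true  = new-peak g w a<M c<M d<M c-peak IH-suc (2*peaksAux≤length d w)

    insertionSum≡insertionCount : ∀ g a w → a < M → All (_< M) w → insertionSum g a w ≡ insertionCount g a w
    insertionSum≡insertionCount g a [] a<M [] = sym (ℕ.+-identityʳ _)
    insertionSum≡insertionCount g a (c ∷ []) a<M (c<M ∷ [])
      rewrite <⇒<ᵇ≡true a<M | <⇒<ᵇ≡true c<M | >⇒<ᵇ≡false {M} {c} c<M | ∧-zeroʳ (a <ᵇ c) = rearrange (g 0) (g 1)
      where
      rearrange : ∀ x y → y + (x + 0) ≡ 1 * x + 1 * y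
      rearrange = solve-∀
    insertionSum≡insertionCount g a (c ∷ d ∷ w) a<M (c<M ∷ d<M ∷ w<M) =
      extend g w a<M c<M d<M (insertionSum≡insertionCount g c (d ∷ w) c<M (d<M ∷ w<M))
                             (insertionSum≡insertionCount (λ k → g (suc k)) c (d ∷ w) c<M (d<M ∷ w<M))

  open MaximumInsertion using (insertionSum≡insertionCount)

  All-insertEverywhere : ∀ {Q : ℕ → Set} {x} u → Q x → All Q u →
                         All (λ v → All Q v × length v ≡ suc (length u)) (insertEverywhere x u)
  All-insertEverywhere []      Qx []         = ((Qx ∷ []) , refl) ∷ []
  All-insertEverywhere (y ∷ u) Qx (Qy ∷ Qu) =
    ((Qx ∷ Qy ∷ Qu) , refl) ∷ All.map⁺ (All.map (λ (Qv , len) → (Qy ∷ Qv) , cong suc len) (All-insertEverywhere u Qx Qu))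

  All-concatMap : ∀ {A B : Set} {Q : B → Set} (f : A → List B) xs → All (λ x → All Q (f x)) xs → All Q (concatMap f xs)
  All-concatMap f []       []         = []
  All-concatMap f (x ∷ xs) (Qfx ∷ Qfxs) = All.++⁺ Qfx (All-concatMap f xs Qfxs)

  All-perms : ∀ {Q : ℕ → Set} L → All Q L → All (λ u → All Q u × length u ≡ length L) (perms L)
  All-perms []       []        = ([] , refl) ∷ []
  All-perms (x ∷ xs) (Qx ∷ Qxs) = All-concatMap (insertEverywhere x) (perms xs)
    (All.map (λ (Qu , len) → All.map (λ (Qv , len′) → Qv , trans len′ (cong suc len)) (All-insertEverywhere _ Qx Qu))
             (All-perms xs Qxs))

  oneTo-< : ∀ m → All (_< suc m) (oneTo m)
  oneTo-< zero    = []
  oneTo-< (suc m) = All.++⁺ (All.map ℕ.m<n⇒m<1+n (oneTo-< m)) (ℕ.≤-refl ∷ [])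

  length-oneTo : ∀ m → length (oneTo m) ≡ m
  length-oneTo zero    = refl
  length-oneTo (suc m) = trans (List.length-++ (oneTo m)) (trans (ℕ.+-comm (length (oneTo m)) 1) (cong suc (length-oneTo m)))

  All-perms-oneTo : ∀ m → All (λ u → All (_< suc m) u × length u ≡ m) (perms (oneTo m))
  All-perms-oneTo m = All.map (λ (u<1+m , len) → u<1+m , trans len (length-oneTo m)) (All-perms (oneTo m) (oneTo-< m))

  P≡sumMap : ∀ m k → P m k ≡ sumMap (λ u → δ (leftPeaks u) k) (perms (oneTo m))
  P≡sumMap m k = length-filter leftPeaks k (perms (oneTo m))

  P-suc : ∀ m k → P (suc m) k ≡
          sumMap (λ u → suc (2 * leftPeaks u) * δ (leftPeaks u) k + (m ∸ 2 * leftPeaks u) * δ (suc (leftPeaks u)) k) (perms (oneTo m))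
  P-suc m k = begin
    length (filter (λ w → leftPeaks w ℕ.≟ k) (perms (oneTo m ++ suc m ∷ [])))
      ≡⟨ ↭-length (filter-↭ (λ w → leftPeaks w ℕ.≟ k) (perms-∷ʳ (oneTo m) (suc m))) ⟩
    length (filter (λ w → leftPeaks w ℕ.≟ k) (concatMap (insertEverywhere (suc m)) (perms (oneTo m))))
      ≡⟨ length-filter leftPeaks k (concatMap (insertEverywhere (suc m)) (perms (oneTo m))) ⟩
    sumMap (λ w → δ (leftPeaks w) k) (concatMap (insertEverywhere (suc m)) (perms (oneTo m)))
      ≡⟨ sumMap-concatMap _ (insertEverywhere (suc m)) (perms (oneTo m)) ⟩
    sumMap (λ u → sumMap (λ w → δ (leftPeaks w) k) (insertEverywhere (suc m) u)) (perms (oneTo m))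
      ≡⟨ sumMap-cong-All (All.map (λ {u} (u<1+m , len) →
           trans (insertionSum≡insertionCount (suc m) (λ x → δ x k) 0 u (s≤s z≤n) u<1+m)
                 (cong (λ n → suc (2 * leftPeaks u) * δ (leftPeaks u) k + (n ∸ 2 * leftPeaks u) * δ (suc (leftPeaks u)) k) len))
           (All-perms-oneTo m)) ⟩
    sumMap (λ u → suc (2 * leftPeaks u) * δ (leftPeaks u) k + (m ∸ 2 * leftPeaks u) * δ (suc (leftPeaks u)) k) (perms (oneTo m)) ∎

  P-suc-zero : ∀ N → P (suc N) 0 ≡ P N 0
  P-suc-zero N = begin
    P (suc N) 0 ≡⟨ P-suc N 0 ⟩
    sumMap (λ u → suc (2 * leftPeaks u) * δ (leftPeaks u) 0 + (N ∸ 2 * leftPeaks u) * 0) (perms (oneTo N))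
      ≡⟨ sumMap-cong (λ u → trans (cong (suc (2 * leftPeaks u) * δ (leftPeaks u) 0 +_) (ℕ.*-zeroʳ (N ∸ 2 * leftPeaks u)))
                              (trans (ℕ.+-identityʳ _) (trans (δ-subst (λ z → suc (2 * z)) (leftPeaks u) 0) (ℕ.+-identityʳ _))))
                     (perms (oneTo N)) ⟩
    sumMap (λ u → δ (leftPeaks u) 0) (perms (oneTo N)) ≡⟨ P≡sumMap N 0 ⟨
    P N 0 ∎

  P-suc-suc : ∀ N k → P (suc N) (suc k) ≡ (3 + 2 * k) * P N (suc k) + (N ∸ 2 * k) * P N k
  P-suc-suc N k = begin
    P (suc N) (suc k) ≡⟨ P-suc N (suc k) ⟩
    sumMap (λ u → suc (2 * leftPeaks u) * δ (leftPeaks u) (suc k) + (N ∸ 2 * leftPeaks u) * δ (leftPeaks u) k) (perms (oneTo N))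
      ≡⟨ sumMap-cong (λ u → cong₂ _+_ (δ-subst (λ z → suc (2 * z)) (leftPeaks u) (suc k)) (δ-subst (λ z → N ∸ 2 * z) (leftPeaks u) k))
                     (perms (oneTo N)) ⟩
    sumMap (λ u → suc (2 * suc k) * δ (leftPeaks u) (suc k) + (N ∸ 2 * k) * δ (leftPeaks u) k) (perms (oneTo N))
      ≡⟨ sumMap-+ _ _ (perms (oneTo N)) ⟩
    sumMap (λ u → suc (2 * suc k) * δ (leftPeaks u) (suc k)) (perms (oneTo N)) + sumMap (λ u → (N ∸ 2 * k) * δ (leftPeaks u) k) (perms (oneTo N))
      ≡⟨ cong₂ _+_ (sumMap-* (suc (2 * suc k)) _ (perms (oneTo N))) (sumMap-* (N ∸ 2 * k) _ (perms (oneTo N))) ⟩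
    suc (2 * suc k) * sumMap (λ u → δ (leftPeaks u) (suc k)) (perms (oneTo N)) + (N ∸ 2 * k) * sumMap (λ u → δ (leftPeaks u) k) (perms (oneTo N))
      ≡⟨ cong₂ _+_ (cong₂ _*_ (cong suc (2*suc k)) (sym (P≡sumMap N (suc k)))) (cong ((N ∸ 2 * k) *_) (sym (P≡sumMap N k))) ⟩
    (3 + 2 * k) * P N (suc k) + (N ∸ 2 * k) * P N k ∎

  P-vanish : ∀ N k → N < 2 * k → P N k ≡ 0
  P-vanish N k N<2k = begin
    P N k                                             ≡⟨ P≡sumMap N k ⟩
    sumMap (λ u → δ (leftPeaks u) k) (perms (oneTo N)) ≡⟨ sumMap-cong-All (All.map (λ {u} (_ , len) → no-k-peaks u len) (All-perms-oneTo N)) ⟩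
    sumMap (λ _ → 0) (perms (oneTo N))                ≡⟨ sumMap-zero (perms (oneTo N)) ⟩
    0                                                 ∎
    where
    no-k-peaks : ∀ u → length u ≡ N → δ (leftPeaks u) k ≡ 0
    no-k-peaks u len with leftPeaks u ≡ᵇ k in peaks≡ᵇk
    ... | false = refl
    ... | true  = ⊥-elim (ℕ.<-irrefl refl (ℕ.≤-<-trans 2k≤N N<2k))
      where
      2k≤N : 2 * k ≤ N
      2k≤N = subst (λ n → 2 * n ≤ N) (ℕ.≡ᵇ⇒≡ (leftPeaks u) k (subst T (sym peaks≡ᵇk) _))
                   (subst (2 * leftPeaks u ≤_) len (2*peaksAux≤length 0 u))
    sumMap-zero : ∀ (us : List (List ℕ)) → sumMap (λ _ → 0) us ≡ 0
    sumMap-zero []       = refl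
    sumMap-zero (_ ∷ us) = sumMap-zero us

module OddCoefficients where

  open import Data.Nat as ℕ using (ℕ; zero; suc; _∸_; _+_; _*_; _<_; _≥_)
  import Data.Nat.Properties as ℕ
  open import Data.Nat.Tactic.RingSolver using (solve-∀)
  open import Relation.Binary.PropositionalEquality
  open ≡-Reasoning
  open import Defs using (ℕtoℚ; b; S; P)
  open CoefficientsOfD using (bℕ; b≡bℕ)
  open StirlingFactorisation using (cofactor; bℕ≡S*cofactor)
  open LeftPeaks using (P-suc-zero; P-suc-suc; P-vanish; 2*suc)

  cofactor-odd≡P : ∀ N k j → 2 * k + j ≡ N → cofactor N (suc (2 * k)) j ≡ P N k
  cofactor-odd≡P zero    zero    zero    _ = refl
  cofactor-odd≡P zero    (suc k) j       e with () ← trans (sym (cong (_+ j) (2*suc k))) e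
  cofactor-odd≡P (suc N) zero    zero    ()
  cofactor-odd≡P (suc N) zero    (suc j) e = begin
    1 * cofactor N 1 j + suc (suc j) * 0 ≡⟨ cong (λ c → 1 * c + suc (suc j) * 0) (cofactor-odd≡P N 0 j (ℕ.suc-injective e)) ⟩
    1 * P N 0 + suc (suc j) * 0          ≡⟨ simplify (P N 0) j ⟩
    P N 0                                ≡⟨ P-suc-zero N ⟨
    P (suc N) 0                          ∎
    where
    simplify : ∀ x j → 1 * x + suc (suc j) * 0 ≡ x
    simplify = solve-∀
  cofactor-odd≡P (suc N) (suc k) j e =
    trans (cong (λ n → cofactor (suc N) (suc n) j) (2*suc k)) (step j (trans (sym (cong (_+ j) (2*suc k))) e))
    where
    step : ∀ j → suc (suc (2 * k + j)) ≡ suc N → cofactor (suc N) (suc (suc (suc (2 * k)))) j ≡ P (suc N) (suc k)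
    step zero e′ = begin
      suc (suc (suc (2 * k))) * 0 + 1 * cofactor N (suc (2 * k)) 1
        ≡⟨ cong (λ c → suc (suc (suc (2 * k))) * 0 + 1 * c) (cofactor-odd≡P N k 1 (trans (ℕ.+-suc (2 * k) 0) (ℕ.suc-injective e′))) ⟩
      (3 + 2 * k) * 0 + 1 * P N k
        ≡⟨ cong₂ (λ x y → (3 + 2 * k) * x + y * P N k) (sym (P-vanish N (suc k) N<2+2k)) (sym N∸2k≡1) ⟩
      (3 + 2 * k) * P N (suc k) + (N ∸ 2 * k) * P N k
        ≡⟨ P-suc-suc N k ⟨
      P (suc N) (suc k) ∎
      where
      N≡1+2k : N ≡ suc (2 * k)
      N≡1+2k = trans (sym (ℕ.suc-injective e′)) (cong suc (ℕ.+-identityʳ (2 * k)))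
      N<2+2k : N < 2 * suc k
      N<2+2k rewrite N≡1+2k | 2*suc k = ℕ.≤-refl
      N∸2k≡1 : N ∸ 2 * k ≡ 1
      N∸2k≡1 = trans (cong (_∸ 2 * k) N≡1+2k) (ℕ.m+n∸n≡m 1 (2 * k))
    step (suc j) e′ = begin
      suc (suc (suc (2 * k))) * cofactor N (suc (suc (suc (2 * k)))) j + suc (suc j) * cofactor N (suc (2 * k)) (suc (suc j))
        ≡⟨ cong₂ (λ x y → suc (suc (suc (2 * k))) * x + suc (suc j) * y)
                 (trans (cong (λ n → cofactor N (suc n) j) (sym (2*suc k)))
                        (cofactor-odd≡P N (suc k) j (trans (cong (_+ j) (2*suc k)) (trans (cong suc (sym (ℕ.+-suc (2 * k) j))) (ℕ.suc-injective e′)))))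
                 (cofactor-odd≡P N k (suc (suc j)) (trans (ℕ.+-suc (2 * k) (suc j)) (ℕ.suc-injective e′))) ⟩
      (3 + 2 * k) * P N (suc k) + suc (suc j) * P N k
        ≡⟨ cong (λ y → (3 + 2 * k) * P N (suc k) + y * P N k) N∸2k≡2+j ⟨
      (3 + 2 * k) * P N (suc k) + (N ∸ 2 * k) * P N k
        ≡⟨ P-suc-suc N k ⟨
      P (suc N) (suc k) ∎
      where
      N∸2k≡2+j : N ∸ 2 * k ≡ suc (suc j)
      N∸2k≡2+j = begin
        N ∸ 2 * k                      ≡⟨ cong (_∸ 2 * k) (ℕ.suc-injective e′) ⟨
        suc (2 * k + suc j) ∸ 2 * k    ≡⟨ cong (λ n → suc n ∸ 2 * k) (trans (ℕ.+-suc (2 * k) j) (cong suc (ℕ.+-comm (2 * k) j))) ⟩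
        suc (suc j) + 2 * k ∸ 2 * k    ≡⟨ ℕ.m+n∸n≡m (suc (suc j)) (2 * k) ⟩
        suc (suc j)                    ∎

  b-odd≡S*P : (n i j : ℕ) → n ≥ 1 → i ≥ 1 → j ≥ 1 →
              b n (2 * i ∸ 1) j ≡ ℕtoℚ (S (n + 1) (2 * i ∸ 1 + j) * P (2 * i ∸ 2 + j) (i ∸ 1))
  b-odd≡S*P n (suc k) j _ _ _ = begin
    b n (2 * suc k ∸ 1) j                                    ≡⟨ cong (λ i → b n i j) 2[1+k]∸1≡1+2k ⟩
    b n (suc (2 * k)) j                                      ≡⟨ b≡bℕ n (suc (2 * k)) j ⟩
    ℕtoℚ (bℕ n (suc (2 * k)) j)                               ≡⟨ cong ℕtoℚ (bℕ≡S*cofactor n (2 * k + j) (suc (2 * k)) j refl) ⟩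
    ℕtoℚ (S (suc n) (suc (2 * k + j)) * cofactor (2 * k + j) (suc (2 * k)) j)
      ≡⟨ cong (λ c → ℕtoℚ (S (suc n) (suc (2 * k + j)) * c)) (cofactor-odd≡P (2 * k + j) k j refl) ⟩
    ℕtoℚ (S (suc n) (suc (2 * k) + j) * P (2 * k + j) k)
      ≡⟨ cong ℕtoℚ (cong₂ _*_ (cong₂ S (ℕ.+-comm 1 n) (cong (_+ j) (sym 2[1+k]∸1≡1+2k)))
                              (cong (λ m → P (m + j) k) (sym (cong (_∸ 2) (2*suc k))))) ⟩
    ℕtoℚ (S (n + 1) (2 * suc k ∸ 1 + j) * P (2 * suc k ∸ 2 + j) (suc k ∸ 1)) ∎
    where
    2[1+k]∸1≡1+2k : 2 * suc k ∸ 1 ≡ suc (2 * k)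
    2[1+k]∸1≡1+2k = cong (_∸ 1) (2*suc k)

module GeneratingFunction where

  open import Data.Nat as ℕ using (ℕ; zero; suc; _∸_; _<_; _≤_; s≤s; z≤n)
  import Data.Nat.Properties as ℕ
  open import Data.Rational as ℚ using (ℚ; 0ℚ; 1ℚ)
  import Data.Rational.Properties as ℚ
  open import Relation.Binary.PropositionalEquality as ≡ using (_≡_)
  open import Defs
  open RationalFacts

  module ℚ[[q]]     = PowerSeries ℚ.+-*-commutativeRing
  module ℚ[[q,p]]   = PowerSeries ℚ[[q]].commutativeRing
  module ℚ[[q,p,x]] = PowerSeries ℚ[[q,p]].commutativeRing

  const₂ : ℚ → ℚ[[q,p]].Series
  const₂ r = ℚ[[q,p]].C (ℚ[[q]].C r)

  const₃ : ℚ → ℚ[[q,p,x]].Series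
  const₃ r = ℚ[[q,p,x]].C (const₂ r)

  p q : ℚ[[q,p]].Series
  p = ℚ[[q,p]].X
  q = ℚ[[q,p]].C ℚ[[q]].X

  p̂ q̂ exp : ℚ[[q,p,x]].Series
  p̂ = ℚ[[q,p,x]].C p
  q̂ = ℚ[[q,p,x]].C q
  exp n = const₂ (inv! n)

  module OperatorL where

    open CommutativeRing ℚ[[q,p]].commutativeRing
    open import Relation.Binary.Reasoning.Setoid setoid
    open ℚ[[q,p]].SeriesRing using (IsDerivation; linearCombination)

    ∂p ∂q : ℚ[[q,p]].Series → ℚ[[q,p]].Series
    ∂p = ℚ[[q,p]].∂
    ∂q = ℚ[[q,p]].lift ℚ[[q]].∂

    L : ℚ[[q,p]].Series → ℚ[[q,p]].Series
    L f = (p + p * q) * ∂p f + (q + p * p) * ∂q f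

    L-isDerivation : IsDerivation L
    L-isDerivation = linearCombination (p + p * q) (q + p * p) ℚ[[q,p]].∂-isDerivation
                                       (ℚ[[q,p]].lift-isDerivation ℚ[[q]].∂-isDerivation)

    private
      ∂q-p : ∂q p ≈ 0#
      ∂q-p zero          j = ℚ.*-zeroʳ (ℚ[[q]].ι (suc j))
      ∂q-p (suc zero)      = ℚ[[q]].∂-C 1ℚ
      ∂q-p (suc (suc i)) j = ℚ.*-zeroʳ (ℚ[[q]].ι (suc j))

      ∂q-q : ∂q q ≈ 1#
      ∂q-q = trans (ℚ[[q,p]].lift-C ℚ[[q]].∂-isDerivation ℚ[[q]].X) (ℚ[[q,p]].C-cong ℚ[[q]].∂-X)

    L-p : L p ≈ p + p * q
    L-p = begin
      (p + p * q) * ∂p p + (q + p * p) * ∂q p ≈⟨ +-cong (*-congˡ {p + p * q} ℚ[[q,p]].∂-X) (*-congˡ {q + p * p} ∂q-p) ⟩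
      (p + p * q) * 1# + (q + p * p) * 0#     ≈⟨ trans (+-cong (*-identityʳ (p + p * q)) (zeroʳ (q + p * p))) (+-identityʳ (p + p * q)) ⟩
      p + p * q                               ∎

    L-q : L q ≈ q + p * p
    L-q = begin
      (p + p * q) * ∂p q + (q + p * p) * ∂q q ≈⟨ +-cong (*-congˡ {p + p * q} (ℚ[[q,p]].∂-C ℚ[[q]].X)) (*-congˡ {q + p * p} ∂q-q) ⟩
      (p + p * q) * 0# + (q + p * p) * 1#     ≈⟨ trans (+-cong (zeroʳ (p + p * q)) (*-identityʳ (q + p * p))) (+-identityˡ (q + p * p)) ⟩
      q + p * p                               ∎

    L-const : ∀ r → L (const₂ r) ≈ 0#
    L-const r = begin
      (p + p * q) * ∂p (const₂ r) + (q + p * p) * ∂q (const₂ r)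
        ≈⟨ +-cong (*-congˡ {p + p * q} (ℚ[[q,p]].∂-C (ℚ[[q]].C r)))
                  (*-congˡ {q + p * p} (trans (ℚ[[q,p]].lift-C ℚ[[q]].∂-isDerivation (ℚ[[q]].C r)) (ℚ[[q,p]].C-cong (ℚ[[q]].∂-C r)))) ⟩
      (p + p * q) * 0# + (q + p * p) * ℚ[[q,p]].C ℚ[[q]].𝟘
        ≈⟨ +-cong (zeroʳ (p + p * q)) (*-congˡ {q + p * p} C-0) ⟩
      0# + (q + p * p) * 0#   ≈⟨ trans (+-identityˡ _) (zeroʳ (q + p * p)) ⟩
      0#                      ∎
      where
      C-0 : ℚ[[q,p]].C ℚ[[q]].𝟘 ≈ 0#
      C-0 zero    j = ≡.refl
      C-0 (suc i) j = ≡.refl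

  module OperatorL-coefficients where

    open OperatorL
    open CommutativeRing ℚ[[q,p]].commutativeRing using (_*_; _+_; _≈_; refl)
    open ≡.≡-Reasoning
    open CoefficientsOfD using (yShift; x²y⁻¹Shift; DCoeff)
    open import Data.Rational.Solver using (module +-*-Solver)

    private
      ∂p-coeff : ∀ f i j → ∂p f i j ≡ ℕtoℚ (suc i) ℚ.* f (suc i) j
      ∂p-coeff f i j = ≡.trans (ℚ[[q]].⊠-cong {g = f (suc i)} (ℚ[[q]].C-ι (suc i)) (λ _ → ≡.refl) j)
        (≡.trans (ℚ[[q]].C-⊠ (ℚ[[q]].ι (suc i)) (f (suc i)) j) (≡.cong (ℚ._* f (suc i) j) (ι≡ℕtoℚ (suc i))))

      ∂q-coeff : ∀ f i j → ∂q f i j ≡ ℕtoℚ (suc j) ℚ.* f i (suc j)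
      ∂q-coeff f i j = ≡.cong (ℚ._* f i (suc j)) (ι≡ℕtoℚ (suc j))

      q-⊠-zero : ∀ f i → (q * f) i 0 ≡ 0ℚ
      q-⊠-zero f i = ≡.trans (ℚ[[q,p]].C-⊠ ℚ[[q]].X f i 0) (ℚ[[q]].X-⊠-zero (f i))

      q-⊠-suc : ∀ f i j → (q * f) i (suc j) ≡ f i j
      q-⊠-suc f i j = ≡.trans (ℚ[[q,p]].C-⊠ ℚ[[q]].X f i (suc j)) (ℚ[[q]].X-⊠-suc (f i) j)

      collect : ∀ I J J′ x y z → I ℚ.* x ℚ.+ I ℚ.* y ℚ.+ J ℚ.* x ℚ.+ J′ ℚ.* z ≡ (I ℚ.+ J) ℚ.* x ℚ.+ I ℚ.* y ℚ.+ J′ ℚ.* z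
      collect = solve 6 (λ I J J′ x y z → I :* x :+ I :* y :+ J :* x :+ J′ :* z := (I :+ J) :* x :+ I :* y :+ J′ :* z) ≡.refl
        where open +-*-Solver

    module _ (β : ℚ[[q,p]].Series) where
      private
        p∂p : ∀ i j → (p * ∂p β) i j ≡ ℕtoℚ i ℚ.* β i j
        p∂p zero    j = ≡.trans (ℚ[[q,p]].X-⊠-zero (∂p β) j) (≡.sym (ℚ.*-zeroˡ (β 0 j)))
        p∂p (suc i) j = ≡.trans (ℚ[[q,p]].X-⊠-suc (∂p β) i j) (∂p-coeff β i j)

        pq∂p : ∀ i j → (p * (q * ∂p β)) i j ≡ ℕtoℚ i ℚ.* yShift 0ℚ β i j
        pq∂p zero    j       = ≡.trans (ℚ[[q,p]].X-⊠-zero (q * ∂p β) j) (≡.sym (ℚ.*-zeroˡ (yShift 0ℚ β 0 j)))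
        pq∂p (suc i) zero    = ≡.trans (ℚ[[q,p]].X-⊠-suc (q * ∂p β) i 0) (≡.trans (q-⊠-zero (∂p β) i) (≡.sym (ℚ.*-zeroʳ (ℕtoℚ (suc i)))))
        pq∂p (suc i) (suc j) = ≡.trans (ℚ[[q,p]].X-⊠-suc (q * ∂p β) i (suc j)) (≡.trans (q-⊠-suc (∂p β) i j) (∂p-coeff β i j))

        q∂q : ∀ i j → (q * ∂q β) i j ≡ ℕtoℚ j ℚ.* β i j
        q∂q i zero    = ≡.trans (q-⊠-zero (∂q β) i) (≡.sym (ℚ.*-zeroˡ (β i 0)))
        q∂q i (suc j) = ≡.trans (q-⊠-suc (∂q β) i j) (∂q-coeff β i j)

        pp∂q : ∀ i j → (p * (p * ∂q β)) i j ≡ ℕtoℚ (suc j) ℚ.* x²y⁻¹Shift 0ℚ β i j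
        pp∂q zero          j = ≡.trans (ℚ[[q,p]].X-⊠-zero (p * ∂q β) j) (≡.sym (ℚ.*-zeroʳ (ℕtoℚ (suc j))))
        pp∂q (suc zero)    j = ≡.trans (ℚ[[q,p]].X-⊠-suc (p * ∂q β) 0 j)
                                 (≡.trans (ℚ[[q,p]].X-⊠-zero (∂q β) j) (≡.sym (ℚ.*-zeroʳ (ℕtoℚ (suc j)))))
        pp∂q (suc (suc i)) j = ≡.trans (ℚ[[q,p]].X-⊠-suc (p * ∂q β) (suc i) j)
                                 (≡.trans (ℚ[[q,p]].X-⊠-suc (∂q β) i j) (∂q-coeff β i j))

        expand : L β ≈ p * ∂p β + p * (q * ∂p β) + q * ∂q β + p * (p * ∂q β)
        expand = solve 4 (λ p q a b → (p :+ p :* q) :* a :+ (q :+ p :* p) :* b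
                                      := p :* a :+ p :* (q :* a) :+ q :* b :+ p :* (p :* b))
                         refl p q (∂p β) (∂q β)
          where open ℚ[[q,p]].SeriesRing using (solve; _:+_; _:*_; _:=_)

      L-coeff : ∀ i j → L β i j ≡ DCoeff β i j
      L-coeff i j = begin
        L β i j
          ≡⟨ expand i j ⟩
        (p * ∂p β + p * (q * ∂p β) + q * ∂q β + p * (p * ∂q β)) i j
          ≡⟨ ≡.cong₂ ℚ._+_ (≡.cong₂ ℚ._+_ (≡.cong₂ ℚ._+_ (p∂p i j) (pq∂p i j)) (q∂q i j)) (pp∂q i j) ⟩
        ℕtoℚ i ℚ.* β i j ℚ.+ ℕtoℚ i ℚ.* yShift 0ℚ β i j ℚ.+ ℕtoℚ j ℚ.* β i j ℚ.+ ℕtoℚ (suc j) ℚ.* x²y⁻¹Shift 0ℚ β i j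
          ≡⟨ collect (ℕtoℚ i) (ℕtoℚ j) (ℕtoℚ (suc j)) (β i j) (yShift 0ℚ β i j) (x²y⁻¹Shift 0ℚ β i j) ⟩
        (ℕtoℚ i ℚ.+ ℕtoℚ j) ℚ.* β i j ℚ.+ ℕtoℚ i ℚ.* yShift 0ℚ β i j ℚ.+ ℕtoℚ (suc j) ℚ.* x²y⁻¹Shift 0ℚ β i j
          ≡⟨ ≡.cong (λ r → r ℚ.* β i j ℚ.+ ℕtoℚ i ℚ.* yShift 0ℚ β i j ℚ.+ ℕtoℚ (suc j) ℚ.* x²y⁻¹Shift 0ℚ β i j)
                    (ℕtoℚ-+ i j) ⟨
        DCoeff β i j ∎

  module Constants where

    open CommutativeRing ℚ[[q,p,x]].commutativeRing using (_≈_; _*_)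
    private
      module R₂ = CommutativeRing ℚ[[q,p]].commutativeRing
      module R₃ = CommutativeRing ℚ[[q,p,x]].commutativeRing

    const₂-cong : ∀ {r s} → r ≡ s → const₂ r R₂.≈ const₂ s
    const₂-cong ≡.refl = R₂.refl

    const₃-cong : ∀ {r s} → r ≡ s → const₃ r ≈ const₃ s
    const₃-cong ≡.refl = R₃.refl

    const₂-* : ∀ r s → const₂ (r ℚ.* s) R₂.≈ const₂ r R₂.* const₂ s
    const₂-* r s = R₂.trans (ℚ[[q,p]].C-cong (ℚ[[q]].C-* r s)) (ℚ[[q,p]].C-* (ℚ[[q]].C r) (ℚ[[q]].C s))

    const₃-* : ∀ r s → const₃ (r ℚ.* s) ≈ const₃ r * const₃ s
    const₃-* r s = R₃.trans (ℚ[[q,p,x]].C-cong (const₂-* r s)) (ℚ[[q,p,x]].C-* (const₂ r) (const₂ s))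

    ι₂≈const₂ : ∀ k → ℚ[[q,p]].SeriesRing.ι k R₂.≈ const₂ (ℕtoℚ k)
    ι₂≈const₂ k = R₂.trans (ℚ[[q,p]].C-ι k)
      (ℚ[[q,p]].C-cong (CommutativeRing.trans ℚ[[q]].commutativeRing (ℚ[[q]].C-ι k) (ℚ[[q]].C-cong (ι≡ℕtoℚ k))))

    ι₃≈const₃ : ∀ k → ℚ[[q,p,x]].SeriesRing.ι k ≈ const₃ (ℕtoℚ k)
    ι₃≈const₃ k = R₃.trans (ℚ[[q,p,x]].C-ι k) (ℚ[[q,p,x]].C-cong (ι₂≈const₂ k))

    ∂x-coeff : ∀ f n i j → ℚ[[q,p,x]].∂ f n i j ≡ ℕtoℚ (suc n) ℚ.* f (suc n) i j
    ∂x-coeff f n i j = ≡.trans (ℚ[[q,p]].⊠-cong {g = f (suc n)} (ι₂≈const₂ (suc n)) (λ _ _ → ≡.refl) i j)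
      (≡.trans (ℚ[[q,p]].C-⊠ (ℚ[[q]].C (ℕtoℚ (suc n))) (f (suc n)) i j) (ℚ[[q]].C-⊠ (ℕtoℚ (suc n)) (f (suc n) i) j))

  module Solutions where

    open CommutativeRing ℚ[[q,p,x]].commutativeRing
    open import Relation.Binary.Reasoning.Setoid setoid
    open import Algebra.Properties.Ring ring using (-0#≈0#)
    open ℚ[[q,p,x]].SeriesRing using (IsDerivation; _^_; ι; ι-suc; ι-*; solve; _:+_; _:*_; _:-_; _:=_; con)
    open ℚ[[q,p,x]] using (Σ∞; Summable; VanishesBelow)
    open OperatorL using (L; L-isDerivation; L-p; L-q; L-const)
    open Constants
    open import Data.Integer using (+_)
    private
      module R₂ = CommutativeRing ℚ[[q,p]].commutativeRing

    ∂x L̂ : ℚ[[q,p,x]].Series → ℚ[[q,p,x]].Series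
    ∂x = ℚ[[q,p,x]].∂
    L̂  = ℚ[[q,p,x]].lift L

    module ∂x = IsDerivation ℚ[[q,p,x]].∂-isDerivation
    module L̂  = IsDerivation (ℚ[[q,p,x]].lift-isDerivation L-isDerivation)

    T Δ : ℚ[[q,p,x]].Series
    T = exp - 1#
    Δ = q̂ * q̂ - p̂ * p̂

    E : ℕ → ℚ[[q,p,x]].Series
    E m = const₃ (inv! m) * T ^ m

    Ch-term Sh-term : ℕ → ℚ[[q,p,x]].Series
    Ch-term k = Δ ^ k * E (2 ℕ.* k)
    Sh-term k = Δ ^ k * E (suc (2 ℕ.* k))

    Ch Sh U : ℚ[[q,p,x]].Series
    Ch = Σ∞ Ch-term
    Sh = Σ∞ Sh-term
    U  = Ch - q̂ * Sh

    ∂x-C : ∀ a → ∂x (ℚ[[q,p,x]].C a) ≈ 0#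
    ∂x-C = ℚ[[q,p,x]].∂-C

    L̂-C : ∀ a → L̂ (ℚ[[q,p,x]].C a) ≈ ℚ[[q,p,x]].C (L a)
    L̂-C = ℚ[[q,p,x]].lift-C L-isDerivation

    L̂-const : ∀ r → L̂ (const₃ r) ≈ 0#
    L̂-const r = trans (L̂-C (const₂ r)) (trans (ℚ[[q,p,x]].C-cong (L-const r)) C-0)
      where
      C-0 : ℚ[[q,p,x]].C R₂.0# ≈ 0#
      C-0 zero    = R₂.refl
      C-0 (suc n) = R₂.refl

    L̂-p̂ : L̂ p̂ ≈ p̂ + p̂ * q̂
    L̂-p̂ = trans (L̂-C p) (trans (ℚ[[q,p,x]].C-cong L-p) (trans (ℚ[[q,p,x]].C-+ p (p R₂.* q)) (+-congˡ {p̂} (ℚ[[q,p,x]].C-* p q))))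

    L̂-q̂ : L̂ q̂ ≈ q̂ + p̂ * p̂
    L̂-q̂ = trans (L̂-C q) (trans (ℚ[[q,p,x]].C-cong L-q) (trans (ℚ[[q,p,x]].C-+ q (p R₂.* p)) (+-congˡ {q̂} (ℚ[[q,p,x]].C-* p p))))

    ∂x-exp : ∂x exp ≈ exp
    ∂x-exp n = R₂.trans (R₂.*-congʳ {exp (suc n)} (ι₂≈const₂ (suc n)))
                        (R₂.trans (R₂.sym (const₂-* (ℕtoℚ (suc n)) (inv! (suc n)))) (const₂-cong (ℕtoℚ-suc-*-inv!-suc n)))

    L̂-exp : L̂ exp ≈ 0#
    L̂-exp n = L-const (inv! n)

    ∂x-T : ∂x T ≈ exp
    ∂x-T = begin
      ∂x (exp - 1#)     ≈⟨ ∂x.-‿-homo exp 1# ⟩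
      ∂x exp - ∂x 1#    ≈⟨ +-cong ∂x-exp (-‿cong ∂x.1-homo) ⟩
      exp - 0#          ≈⟨ +-congˡ {exp} -0#≈0# ⟩
      exp + 0#          ≈⟨ +-identityʳ exp ⟩
      exp               ∎

    L̂-T : L̂ T ≈ 0#
    L̂-T = begin
      L̂ (exp - 1#)      ≈⟨ L̂.-‿-homo exp 1# ⟩
      L̂ exp - L̂ 1#      ≈⟨ +-cong L̂-exp (-‿cong L̂.1-homo) ⟩
      0# - 0#           ≈⟨ -‿inverseʳ 0# ⟩
      0#                ∎

    T-vanishesBelow-1 : VanishesBelow 1 T
    T-vanishesBelow-1 zero    _           = R₂.-‿inverseʳ R₂.1#
    T-vanishesBelow-1 (suc n) (s≤s ())

    ∂x-Δ : ∂x Δ ≈ 0#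
    ∂x-Δ = begin
      ∂x (q̂ * q̂ - p̂ * p̂)              ≈⟨ ∂x.-‿-homo (q̂ * q̂) (p̂ * p̂) ⟩
      ∂x (q̂ * q̂) - ∂x (p̂ * p̂)         ≈⟨ +-cong (∂x-square q̂ (∂x-C q)) (-‿cong (∂x-square p̂ (∂x-C p))) ⟩
      0# - 0#                         ≈⟨ -‿inverseʳ 0# ⟩
      0#                              ∎
      where
      ∂x-square : ∀ a → ∂x a ≈ 0# → ∂x (a * a) ≈ 0#
      ∂x-square a ∂xa≈0 = trans (∂x.leibniz-constˡ a a ∂xa≈0) (trans (*-congˡ {a} ∂xa≈0) (zeroʳ a))

    L̂-Δ : L̂ Δ ≈ ι 2 * Δ
    L̂-Δ = begin
      L̂ (q̂ * q̂ - p̂ * p̂)                               ≈⟨ L̂.-‿-homo (q̂ * q̂) (p̂ * p̂) ⟩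
      L̂ (q̂ * q̂) - L̂ (p̂ * p̂)                          ≈⟨ +-cong (L̂.leibniz q̂ q̂) (-‿cong (L̂.leibniz p̂ p̂)) ⟩
      (L̂ q̂ * q̂ + q̂ * L̂ q̂) - (L̂ p̂ * p̂ + p̂ * L̂ p̂)
        ≈⟨ +-cong (+-cong (*-congʳ {q̂} L̂-q̂) (*-congˡ {q̂} L̂-q̂)) (-‿cong (+-cong (*-congʳ {p̂} L̂-p̂) (*-congˡ {p̂} L̂-p̂))) ⟩
      ((q̂ + p̂ * p̂) * q̂ + q̂ * (q̂ + p̂ * p̂)) - ((p̂ + p̂ * q̂) * p̂ + p̂ * (p̂ + p̂ * q̂))
        ≈⟨ solve 2 (λ p q → ((q :+ p :* p) :* q :+ q :* (q :+ p :* p)) :- ((p :+ p :* q) :* p :+ p :* (p :+ p :* q))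
                            := con (+ 2) :* (q :* q :- p :* p)) refl p̂ q̂ ⟩
      ι 2 * Δ                                          ∎

    L̂-Δ^ : ∀ k → L̂ (Δ ^ k) ≈ ι (2 ℕ.* k) * Δ ^ k
    L̂-Δ^ zero    = trans L̂.1-homo (sym (zeroˡ 1#))
    L̂-Δ^ (suc k) = begin
      L̂ (Δ ^ suc k)                        ≈⟨ L̂.^-homo Δ k ⟩
      ι (suc k) * Δ ^ k * L̂ Δ              ≈⟨ *-congˡ {ι (suc k) * Δ ^ k} L̂-Δ ⟩
      ι (suc k) * Δ ^ k * (ι 2 * Δ)        ≈⟨ solve 4 (λ a b c d → a :* b :* (c :* d) := (c :* a) :* (d :* b)) refl (ι (suc k)) (Δ ^ k) (ι 2) Δ ⟩
      (ι 2 * ι (suc k)) * (Δ * Δ ^ k)      ≈⟨ *-congʳ {Δ * Δ ^ k} (ι-* 2 (suc k)) ⟨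
      ι (2 ℕ.* suc k) * Δ ^ suc k          ∎

    ∂x-Δ^ : ∀ k → ∂x (Δ ^ k) ≈ 0#
    ∂x-Δ^ k = ∂x.annihilates-^ k ∂x-Δ

    E-scale : ∀ m → ι (suc m) * const₃ (inv! (suc m)) ≈ const₃ (inv! m)
    E-scale m = begin
      ι (suc m) * const₃ (inv! (suc m))            ≈⟨ *-congʳ {const₃ (inv! (suc m))} (ι₃≈const₃ (suc m)) ⟩
      const₃ (ℕtoℚ (suc m)) * const₃ (inv! (suc m)) ≈⟨ const₃-* (ℕtoℚ (suc m)) (inv! (suc m)) ⟨
      const₃ (ℕtoℚ (suc m) ℚ.* inv! (suc m))       ≈⟨ const₃-cong (ℕtoℚ-suc-*-inv!-suc m) ⟩
      const₃ (inv! m)                               ∎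

    ∂x-E-zero : ∂x (E 0) ≈ 0#
    ∂x-E-zero = begin
      ∂x (const₃ (inv! 0) * 1#)     ≈⟨ ∂x.leibniz-constˡ (const₃ (inv! 0)) 1# (∂x-C (const₂ (inv! 0))) ⟩
      const₃ (inv! 0) * ∂x 1#       ≈⟨ *-congˡ {const₃ (inv! 0)} ∂x.1-homo ⟩
      const₃ (inv! 0) * 0#          ≈⟨ zeroʳ (const₃ (inv! 0)) ⟩
      0#                            ∎

    ∂x-E-suc : ∀ m → ∂x (E (suc m)) ≈ exp * E m
    ∂x-E-suc m = begin
      ∂x (c * T ^ suc m)                ≈⟨ ∂x.leibniz-constˡ c (T ^ suc m) (∂x-C (const₂ (inv! (suc m)))) ⟩
      c * ∂x (T ^ suc m)                ≈⟨ *-congˡ {c} (trans (∂x.^-homo T m) (*-congˡ {ι (suc m) * T ^ m} ∂x-T)) ⟩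
      c * (ι (suc m) * T ^ m * exp)     ≈⟨ solve 4 (λ c i t e → c :* (i :* t :* e) := (i :* c) :* t :* e) refl c (ι (suc m)) (T ^ m) exp ⟩
      (ι (suc m) * c) * T ^ m * exp     ≈⟨ *-congʳ {exp} (*-congʳ {T ^ m} (E-scale m)) ⟩
      const₃ (inv! m) * T ^ m * exp     ≈⟨ *-comm (const₃ (inv! m) * T ^ m) exp ⟩
      exp * E m                         ∎
      where c = const₃ (inv! (suc m))

    suc-*-E-suc : ∀ m → ι (suc m) * E (suc m) ≈ T * E m
    suc-*-E-suc m = begin
      ι (suc m) * (c * (T * T ^ m))     ≈⟨ solve 4 (λ i c t u → i :* (c :* (t :* u)) := t :* ((i :* c) :* u)) refl (ι (suc m)) c T (T ^ m) ⟩
      T * ((ι (suc m) * c) * T ^ m)     ≈⟨ *-congˡ {T} (*-congʳ {T ^ m} (E-scale m)) ⟩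
      T * E m                           ∎
      where c = const₃ (inv! (suc m))

    L̂-E : ∀ m → L̂ (E m) ≈ 0#
    L̂-E m = trans (L̂.leibniz-constˡ (const₃ (inv! m)) (T ^ m) (L̂-const (inv! m)))
                  (trans (*-congˡ {const₃ (inv! m)} (L̂.annihilates-^ m L̂-T)) (zeroʳ (const₃ (inv! m))))

    E-vanishesBelow : ∀ m → VanishesBelow m (E m)
    E-vanishesBelow m = ℚ[[q,p,x]].vanishesBelow-⊠ˡ m (const₃ (inv! m)) (ℚ[[q,p,x]].vanishesBelow-^ T-vanishesBelow-1 m)

    ∂x-Δ^*E : ∀ k m → ∂x (Δ ^ k * E m) ≈ Δ ^ k * ∂x (E m)
    ∂x-Δ^*E k m = ∂x.leibniz-constˡ (Δ ^ k) (E m) (∂x-Δ^ k)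

    L̂-Δ^*E : ∀ k m → L̂ (Δ ^ k * E m) ≈ ι (2 ℕ.* k) * (Δ ^ k * E m)
    L̂-Δ^*E k m = begin
      L̂ (Δ ^ k * E m)                        ≈⟨ L̂.leibniz (Δ ^ k) (E m) ⟩
      L̂ (Δ ^ k) * E m + Δ ^ k * L̂ (E m)      ≈⟨ +-cong (*-congʳ {E m} (L̂-Δ^ k)) (*-congˡ {Δ ^ k} (L̂-E m)) ⟩
      ι (2 ℕ.* k) * Δ ^ k * E m + Δ ^ k * 0#
        ≈⟨ trans (+-congˡ {ι (2 ℕ.* k) * Δ ^ k * E m} (zeroʳ (Δ ^ k))) (+-identityʳ (ι (2 ℕ.* k) * Δ ^ k * E m)) ⟩
      ι (2 ℕ.* k) * Δ ^ k * E m               ≈⟨ *-assoc (ι (2 ℕ.* k)) (Δ ^ k) (E m) ⟩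
      ι (2 ℕ.* k) * (Δ ^ k * E m)             ∎

    E-2*suc : ∀ k → E (2 ℕ.* suc k) ≈ E (suc (suc (2 ℕ.* k)))
    E-2*suc k = reflexive (≡.cong E (LeftPeaks.2*suc k))

    ∂x-Ch-term-zero : ∂x (Ch-term 0) ≈ 0#
    ∂x-Ch-term-zero = trans (∂x-Δ^*E 0 0) (trans (*-congˡ {1#} ∂x-E-zero) (zeroʳ 1#))

    ∂x-Ch-term-suc : ∀ k → ∂x (Ch-term (suc k)) ≈ (exp * Δ) * Sh-term k
    ∂x-Ch-term-suc k = begin
      ∂x (Δ ^ suc k * E (2 ℕ.* suc k))               ≈⟨ ∂x-Δ^*E (suc k) (2 ℕ.* suc k) ⟩
      Δ ^ suc k * ∂x (E (2 ℕ.* suc k))               ≈⟨ *-congˡ {Δ ^ suc k} (trans (∂x.cong (E-2*suc k)) (∂x-E-suc (suc (2 ℕ.* k)))) ⟩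
      (Δ * Δ ^ k) * (exp * E (suc (2 ℕ.* k)))
        ≈⟨ solve 4 (λ d u e f → (d :* u) :* (e :* f) := (e :* d) :* (u :* f)) refl Δ (Δ ^ k) exp (E (suc (2 ℕ.* k))) ⟩
      (exp * Δ) * Sh-term k                          ∎

    ∂x-Sh-term : ∀ k → ∂x (Sh-term k) ≈ exp * Ch-term k
    ∂x-Sh-term k = begin
      ∂x (Δ ^ k * E (suc (2 ℕ.* k)))         ≈⟨ ∂x-Δ^*E k (suc (2 ℕ.* k)) ⟩
      Δ ^ k * ∂x (E (suc (2 ℕ.* k)))         ≈⟨ *-congˡ {Δ ^ k} (∂x-E-suc (2 ℕ.* k)) ⟩
      Δ ^ k * (exp * E (2 ℕ.* k))            ≈⟨ solve 3 (λ u e f → u :* (e :* f) := e :* (u :* f)) refl (Δ ^ k) exp (E (2 ℕ.* k)) ⟩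
      exp * Ch-term k                        ∎

    L̂-Ch-term-zero : L̂ (Ch-term 0) ≈ 0#
    L̂-Ch-term-zero = trans (L̂-Δ^*E 0 0) (zeroˡ (Ch-term 0))

    L̂-Ch-term-suc : ∀ k → L̂ (Ch-term (suc k)) ≈ (T * Δ) * Sh-term k
    L̂-Ch-term-suc k = begin
      L̂ (Ch-term (suc k))                                         ≈⟨ L̂-Δ^*E (suc k) (2 ℕ.* suc k) ⟩
      ι (2 ℕ.* suc k) * (Δ ^ suc k * E (2 ℕ.* suc k))             ≈⟨ reflexive (≡.cong (λ n → ι n * (Δ ^ suc k * E n)) (LeftPeaks.2*suc k)) ⟩
      ι (suc (suc (2 ℕ.* k))) * (Δ ^ suc k * E (suc (suc (2 ℕ.* k))))
        ≈⟨ solve 3 (λ i u f → i :* (u :* f) := u :* (i :* f)) refl (ι (suc (suc (2 ℕ.* k)))) (Δ ^ suc k) (E (suc (suc (2 ℕ.* k)))) ⟩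
      Δ ^ suc k * (ι (suc (suc (2 ℕ.* k))) * E (suc (suc (2 ℕ.* k)))) ≈⟨ *-congˡ {Δ ^ suc k} (suc-*-E-suc (suc (2 ℕ.* k))) ⟩
      (Δ * Δ ^ k) * (T * E (suc (2 ℕ.* k)))
        ≈⟨ solve 4 (λ d u t f → (d :* u) :* (t :* f) := (t :* d) :* (u :* f)) refl Δ (Δ ^ k) T (E (suc (2 ℕ.* k))) ⟩
      (T * Δ) * Sh-term k                                          ∎

    L̂-Sh-term : ∀ k → L̂ (Sh-term k) ≈ T * Ch-term k - Sh-term k
    L̂-Sh-term k = begin
      L̂ (Sh-term k)                                   ≈⟨ L̂-Δ^*E k (suc (2 ℕ.* k)) ⟩
      ι (2 ℕ.* k) * (Δ ^ k * E (suc (2 ℕ.* k)))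
        ≈⟨ solve 3 (λ i u f → i :* (u :* f) := u :* ((con (+ 1) :+ i) :* f) :- u :* f) refl (ι (2 ℕ.* k)) (Δ ^ k) (E (suc (2 ℕ.* k))) ⟩
      Δ ^ k * ((1# + ι (2 ℕ.* k)) * E (suc (2 ℕ.* k))) - Sh-term k
        ≈⟨ +-congʳ { - Sh-term k} (*-congˡ {Δ ^ k} (trans (*-congʳ {E (suc (2 ℕ.* k))} (sym (ι-suc (2 ℕ.* k))))
                                                         (suc-*-E-suc (2 ℕ.* k)))) ⟩
      Δ ^ k * (T * E (2 ℕ.* k)) - Sh-term k
        ≈⟨ +-congʳ { - Sh-term k} (solve 3 (λ u t f → u :* (t :* f) := t :* (u :* f)) refl (Δ ^ k) T (E (2 ℕ.* k))) ⟩
      T * Ch-term k - Sh-term k                       ∎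

    Ch-term-vanishesBelow : ∀ k → VanishesBelow (2 ℕ.* k) (Ch-term k)
    Ch-term-vanishesBelow k = ℚ[[q,p,x]].vanishesBelow-⊠ˡ (2 ℕ.* k) (Δ ^ k) (E-vanishesBelow (2 ℕ.* k))

    Sh-term-vanishesBelow : ∀ k → VanishesBelow (suc (2 ℕ.* k)) (Sh-term k)
    Sh-term-vanishesBelow k = ℚ[[q,p,x]].vanishesBelow-⊠ˡ (suc (2 ℕ.* k)) (Δ ^ k) (E-vanishesBelow (suc (2 ℕ.* k)))

    private
      k≤2k : ∀ k → k ≤ 2 ℕ.* k
      k≤2k k = ℕ.m≤m+n k (k ℕ.+ 0)

      1+k<2[1+k] : ∀ k → suc k < 2 ℕ.* suc k
      1+k<2[1+k] k = ≡.subst (suc k <_) (≡.sym (LeftPeaks.2*suc k)) (s≤s (s≤s (k≤2k k)))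

    Ch-summable : Summable Ch-term
    Ch-summable k = ℚ[[q,p,x]].vanishesBelow-≤ (k≤2k k) (Ch-term-vanishesBelow k)

    Sh-summable : Summable Sh-term
    Sh-summable k = ℚ[[q,p,x]].vanishesBelow-≤ (ℕ.m≤n⇒m≤1+n (k≤2k k)) (Sh-term-vanishesBelow k)

    private
      Ch-term-diagonal : ∀ n → Ch-term (suc n) (suc n) R₂.≈ R₂.0#
      Ch-term-diagonal n = Ch-term-vanishesBelow (suc n) (suc n) (1+k<2[1+k] n)

      Sh-term-diagonal : ∀ n → Sh-term (suc n) (suc n) R₂.≈ R₂.0#
      Sh-term-diagonal n = Sh-term-vanishesBelow (suc n) (suc n) (ℕ.m≤n⇒m≤1+n (1+k<2[1+k] n))

      *-Sh-term-diagonal : ∀ f n → (f * Sh-term n) n R₂.≈ R₂.0#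
      *-Sh-term-diagonal f n = ℚ[[q,p,x]].vanishesBelow-⊠ˡ (suc (2 ℕ.* n)) f (Sh-term-vanishesBelow n) n (s≤s (k≤2k n))

    ∂x-Ch : ∂x Ch ≈ (exp * Δ) * Sh
    ∂x-Ch = begin
      ∂x (Σ∞ Ch-term)                      ≈⟨ ℚ[[q,p,x]].∂-Σ∞ Ch-term Ch-term-diagonal ⟩
      Σ∞ (λ k → ∂x (Ch-term k))            ≈⟨ ℚ[[q,p,x]].Σ∞-shift _ _ ∂x-Ch-term-zero ∂x-Ch-term-suc (*-Sh-term-diagonal (exp * Δ)) ⟩
      Σ∞ (λ k → (exp * Δ) * Sh-term k)     ≈⟨ ℚ[[q,p,x]].⊠-Σ∞ (exp * Δ) Sh-summable ⟨
      (exp * Δ) * Sh                       ∎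

    ∂x-Sh : ∂x Sh ≈ exp * Ch
    ∂x-Sh = begin
      ∂x (Σ∞ Sh-term)                      ≈⟨ ℚ[[q,p,x]].∂-Σ∞ Sh-term Sh-term-diagonal ⟩
      Σ∞ (λ k → ∂x (Sh-term k))            ≈⟨ ℚ[[q,p,x]].Σ∞-cong ∂x-Sh-term ⟩
      Σ∞ (λ k → exp * Ch-term k)           ≈⟨ ℚ[[q,p,x]].⊠-Σ∞ exp Ch-summable ⟨
      exp * Ch                             ∎

    L̂-Ch : L̂ Ch ≈ (T * Δ) * Sh
    L̂-Ch = begin
      L̂ (Σ∞ Ch-term)                       ≈⟨ ℚ[[q,p,x]].lift-Σ∞ L-isDerivation Ch-term ⟩
      Σ∞ (λ k → L̂ (Ch-term k))             ≈⟨ ℚ[[q,p,x]].Σ∞-shift _ _ L̂-Ch-term-zero L̂-Ch-term-suc (*-Sh-term-diagonal (T * Δ)) ⟩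
      Σ∞ (λ k → (T * Δ) * Sh-term k)       ≈⟨ ℚ[[q,p,x]].⊠-Σ∞ (T * Δ) Sh-summable ⟨
      (T * Δ) * Sh                         ∎

    L̂-Sh : L̂ Sh ≈ T * Ch - Sh
    L̂-Sh = begin
      L̂ (Σ∞ Sh-term)                                   ≈⟨ ℚ[[q,p,x]].lift-Σ∞ L-isDerivation Sh-term ⟩
      Σ∞ (λ k → L̂ (Sh-term k))                         ≈⟨ ℚ[[q,p,x]].Σ∞-cong L̂-Sh-term ⟩
      Σ∞ (λ k → T * Ch-term k - Sh-term k)             ≈⟨ ℚ[[q,p,x]].Σ∞-+ (λ k → T * Ch-term k) (λ k → - Sh-term k) ⟩
      Σ∞ (λ k → T * Ch-term k) + Σ∞ (λ k → - Sh-term k) ≈⟨ +-cong (sym (ℚ[[q,p,x]].⊠-Σ∞ T Ch-summable)) (ℚ[[q,p,x]].Σ∞-⊟ Sh-term) ⟩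
      T * Ch - Sh                                      ∎

    IsSolution : ℚ[[q,p,x]].Series → Set
    IsSolution F = ∂x F ≈ L̂ F - q̂ * F

    private
      exp≈T+1 : exp ≈ T + 1#
      exp≈T+1 = solve 1 (λ e → e := (e :- con (+ 1)) :+ con (+ 1)) refl exp

    U-isSolution : IsSolution U
    U-isSolution = begin
      ∂x (Ch - q̂ * Sh)                            ≈⟨ ∂x.-‿-homo Ch (q̂ * Sh) ⟩
      ∂x Ch - ∂x (q̂ * Sh)
        ≈⟨ +-cong ∂x-Ch (-‿cong (trans (∂x.leibniz-constˡ q̂ Sh (∂x-C q)) (*-congˡ {q̂} ∂x-Sh))) ⟩
      (exp * Δ) * Sh - q̂ * (exp * Ch)
        ≈⟨ +-cong (*-congʳ {Sh} (*-congʳ {Δ} exp≈T+1)) (-‿cong (*-congˡ {q̂} (*-congʳ {Ch} exp≈T+1))) ⟩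
      ((T + 1#) * Δ) * Sh - q̂ * ((T + 1#) * Ch)
        ≈⟨ solve 5 (λ t s c p q → ((t :+ con (+ 1)) :* (q :* q :- p :* p)) :* s :- q :* ((t :+ con (+ 1)) :* c)
                                  := (t :* (q :* q :- p :* p)) :* s :- ((q :+ p :* p) :* s :+ q :* (t :* c :- s)) :- q :* (c :- q :* s))
                   refl T Sh Ch p̂ q̂ ⟩
      (T * Δ) * Sh - ((q̂ + p̂ * p̂) * Sh + q̂ * (T * Ch - Sh)) - q̂ * U ≈⟨ +-congʳ { - (q̂ * U)} L̂-U ⟨
      L̂ U - q̂ * U                                 ∎
      where
      L̂-U : L̂ U ≈ (T * Δ) * Sh - ((q̂ + p̂ * p̂) * Sh + q̂ * (T * Ch - Sh))
      L̂-U = begin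
        L̂ (Ch - q̂ * Sh)                   ≈⟨ L̂.-‿-homo Ch (q̂ * Sh) ⟩
        L̂ Ch - L̂ (q̂ * Sh)                 ≈⟨ +-congˡ {L̂ Ch} (-‿cong (L̂.leibniz q̂ Sh)) ⟩
        L̂ Ch - (L̂ q̂ * Sh + q̂ * L̂ Sh)      ≈⟨ +-cong L̂-Ch (-‿cong (+-cong (*-congʳ {Sh} L̂-q̂) (*-congˡ {q̂} L̂-Sh))) ⟩
        (T * Δ) * Sh - ((q̂ + p̂ * p̂) * Sh + q̂ * (T * Ch - Sh)) ∎

    p̂*exp-isSolution : IsSolution (p̂ * exp)
    p̂*exp-isSolution = begin
      ∂x (p̂ * exp)                         ≈⟨ ∂x.leibniz-constˡ p̂ exp (∂x-C p) ⟩
      p̂ * ∂x exp                           ≈⟨ *-congˡ {p̂} ∂x-exp ⟩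
      p̂ * exp                              ≈⟨ solve 3 (λ p q e → p :* e := ((p :+ p :* q) :* e :+ p :* con (+ 0)) :- q :* (p :* e)) refl p̂ q̂ exp ⟩
      ((p̂ + p̂ * q̂) * exp + p̂ * 0#) - q̂ * (p̂ * exp)
        ≈⟨ +-congʳ { - (q̂ * (p̂ * exp))} (trans (L̂.leibniz p̂ exp) (+-cong (*-congʳ {exp} L̂-p̂) (*-congˡ {p̂} L̂-exp))) ⟨
      L̂ (p̂ * exp) - q̂ * (p̂ * exp)          ∎

    *-U-isSolution : ∀ F → ∂x F ≈ L̂ F → IsSolution (F * U)
    *-U-isSolution F ∂xF≈L̂F = begin
      ∂x (F * U)                             ≈⟨ ∂x.leibniz F U ⟩
      ∂x F * U + F * ∂x U                    ≈⟨ +-cong (*-congʳ {U} ∂xF≈L̂F) (*-congˡ {F} U-isSolution) ⟩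
      L̂ F * U + F * (L̂ U - q̂ * U)
        ≈⟨ solve 5 (λ f u lf lu q → lf :* u :+ f :* (lu :- q :* u) := (lf :* u :+ f :* lu) :- q :* (f :* u)) refl F U (L̂ F) (L̂ U) q̂ ⟩
      (L̂ F * U + F * L̂ U) - q̂ * (F * U)      ≈⟨ +-congʳ { - (q̂ * (F * U))} (L̂.leibniz F U) ⟨
      L̂ (F * U) - q̂ * (F * U)                ∎

    -‿isSolution : ∀ F G → IsSolution F → IsSolution G → IsSolution (F - G)
    -‿isSolution F G F-sol G-sol = begin
      ∂x (F - G)                            ≈⟨ ∂x.-‿-homo F G ⟩
      ∂x F - ∂x G                           ≈⟨ +-cong F-sol (-‿cong G-sol) ⟩
      (L̂ F - q̂ * F) - (L̂ G - q̂ * G)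
        ≈⟨ solve 5 (λ f g lf lg q → (lf :- q :* f) :- (lg :- q :* g) := (lf :- lg) :- q :* (f :- g)) refl F G (L̂ F) (L̂ G) q̂ ⟩
      (L̂ F - L̂ G) - q̂ * (F - G)             ≈⟨ +-congʳ { - (q̂ * (F - G))} (L̂.-‿-homo F G) ⟨
      L̂ (F - G) - q̂ * (F - G)               ∎

    -- (n + 1) W(n + 1) = L (W n) − q W n.
    solution-unique : ∀ W → IsSolution W → W 0 R₂.≈ R₂.0# → W ≈ 0#
    solution-unique W W-sol W₀≈0 zero            = W₀≈0
    solution-unique W W-sol W₀≈0 (suc n) i j     =
      ℕtoℚ-suc-*-cancel n (W (suc n) i j) (≡.trans (≡.sym (∂x-coeff W n i j)) (R₂.trans (W-sol n) rhs≈0 i j))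
      where
      Wₙ≈0 : W n R₂.≈ R₂.0#
      Wₙ≈0 = solution-unique W W-sol W₀≈0 n

      rhs≈0 : (L̂ W - q̂ * W) n R₂.≈ R₂.0#
      rhs≈0 = R₂.trans (R₂.+-cong (R₂.trans (L-isDerivation.cong Wₙ≈0) L-isDerivation.0-homo)
                                  (R₂.-‿cong (R₂.trans (ℚ[[q,p,x]].C-⊠ q W n) (R₂.trans (R₂.*-congˡ {q} Wₙ≈0) (R₂.zeroʳ q)))))
                       (R₂.-‿inverseʳ R₂.0#)
        where module L-isDerivation = ℚ[[q,p]].SeriesRing.IsDerivation L-isDerivation

  module FromDefs where

    open CommutativeRing ℚ[[q,p,x]].commutativeRing using (_≈_; _*_; 1#; refl; trans; *-congˡ)
    open ℚ[[q,p,x]].SeriesRing using (_^_; solve; _:*_; _:=_)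
    open Solutions using (T; Δ; Ch; Sh; U; Ch-term; Sh-term)
    open Constants using (const₃-*)

    Σ≤-ℚ : ∀ n h → ℚ[[q]].Σ≤ n h ≡ Σ≤ n h
    Σ≤-ℚ zero    h = ≡.refl
    Σ≤-ℚ (suc n) h = ≡.cong (ℚ._+ h (suc n)) (Σ≤-ℚ n h)

    Σ≤₁-apply : ∀ n (h : ℕ → ℚ[[q]].Series) j → ℚ[[q,p]].Σ≤ n h j ≡ Σ≤ n (λ a → h a j)
    Σ≤₁-apply n h j = ≡.trans (ℚ[[q]].Σ≤-apply n h j) (Σ≤-ℚ n _)

    Σ≤₂-apply : ∀ n (h : ℕ → ℚ[[q,p]].Series) i j → ℚ[[q,p,x]].Σ≤ n h i j ≡ Σ≤ n (λ a → h a i j)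
    Σ≤₂-apply n h i j = ≡.trans (≡.cong (λ g → g j) (ℚ[[q,p]].Σ≤-apply n h i)) (Σ≤₁-apply n (λ a → h a i) j)

    Σ≤-cong≡ : ∀ n {f g : ℕ → ℚ} → (∀ a → f a ≡ g a) → Σ≤ n f ≡ Σ≤ n g
    Σ≤-cong≡ zero    f≗g = f≗g 0
    Σ≤-cong≡ (suc n) f≗g = ≡.cong₂ ℚ._+_ (Σ≤-cong≡ n f≗g) (f≗g (suc n))

    ⊛-≈ : ∀ {f f′ g g′} → f ≈ f′ → g ≈ g′ → f ⊛ g ≈ f′ * g′
    ⊛-≈ {f} {f′} {g} {g′} f≈f′ g≈g′ n i j = ≡.trans (≡.sym (≡.trans (Σ≤₂-apply n _ i j) (Σ≤-cong≡ n λ a →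
        ≡.trans (Σ≤₁-apply i _ j) (Σ≤-cong≡ i λ c → Σ≤-ℚ j _))))
      (ℚ[[q,p,x]].⊠-cong f≈f′ g≈g′ n i j)

    oneS≈1 : oneS ≈ 1#
    oneS≈1 zero    zero    zero    = ≡.refl
    oneS≈1 zero    zero    (suc j) = ≡.refl
    oneS≈1 zero    (suc i) j       = ≡.refl
    oneS≈1 (suc n) i       j       = ≡.refl

    pS≈p̂ : pS ≈ p̂
    pS≈p̂ zero    zero          j       = ≡.refl
    pS≈p̂ zero    (suc zero)    zero    = ≡.refl
    pS≈p̂ zero    (suc zero)    (suc j) = ≡.refl
    pS≈p̂ zero    (suc (suc i)) j       = ≡.refl
    pS≈p̂ (suc n) i             j       = ≡.refl

    qS≈q̂ : qS ≈ q̂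
    qS≈q̂ zero    zero    zero          = ≡.refl
    qS≈q̂ zero    zero    (suc zero)    = ≡.refl
    qS≈q̂ zero    zero    (suc (suc j)) = ≡.refl
    qS≈q̂ zero    (suc i) j             = ≡.refl
    qS≈q̂ (suc n) i       j             = ≡.refl

    expS≈exp : expS ≈ exp
    expS≈exp n zero    zero    = ≡.refl
    expS≈exp n zero    (suc j) = ≡.refl
    expS≈exp n (suc i) j       = ≡.refl

    powS≈^ : ∀ {f f′} → f ≈ f′ → ∀ k → powS f k ≈ f′ ^ k
    powS≈^ f≈f′ zero    = oneS≈1
    powS≈^ f≈f′ (suc k) = ⊛-≈ f≈f′ (powS≈^ f≈f′ k)

    scale≈const₃-* : ∀ r f → scale r f ≈ const₃ r * f
    scale≈const₃-* r f n i j = ≡.sym (≡.trans (ℚ[[q,p,x]].C-⊠ (const₂ r) f n i j)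
                                      (≡.trans (ℚ[[q,p]].C-⊠ (ℚ[[q]].C r) (f n) i j) (ℚ[[q]].C-⊠ r (f n i) j)))

    ΔS≈Δ : ΔS ≈ Δ
    ΔS≈Δ n i j = ≡.cong₂ ℚ._+_ (⊛-≈ qS≈q̂ qS≈q̂ n i j) (≡.cong ℚ.-_ (⊛-≈ pS≈p̂ pS≈p̂ n i j))

    TS≈T : TS ≈ T
    TS≈T n i j = ≡.cong₂ ℚ._+_ (expS≈exp n i j) (≡.cong ℚ.-_ (oneS≈1 n i j))

    term≈ : ∀ r k m → scale r (powS ΔS k ⊛ powS TS m) ≈ Δ ^ k * (const₃ r * T ^ m)
    term≈ r k m = trans (scale≈const₃-* r (powS ΔS k ⊛ powS TS m))
      (trans (*-congˡ {const₃ r} (⊛-≈ (powS≈^ ΔS≈Δ k) (powS≈^ TS≈T m)))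
             (solve 3 (λ c d t → c :* (d :* t) := d :* (c :* t)) refl (const₃ r) (Δ ^ k) (T ^ m)))

    ChS≈Ch : ChS ≈ Ch
    ChS≈Ch n i j = ≡.trans (Σ≤-cong≡ n λ k → term≈ (inv! (2 ℕ.* k)) k (2 ℕ.* k) n i j)
                           (≡.sym (Σ≤₂-apply n (λ k → Ch-term k n) i j))

    ShS≈Sh : ShS ≈ Sh
    ShS≈Sh n i j = ≡.trans (Σ≤-cong≡ n λ k → term≈ (inv! (suc (2 ℕ.* k))) k (suc (2 ℕ.* k)) n i j)
                           (≡.sym (Σ≤₂-apply n (λ k → Sh-term k n) i j))

    ChS⊖qS⊛ShS≈U : ChS ⊖ (qS ⊛ ShS) ≈ U
    ChS⊖qS⊛ShS≈U n i j = ≡.cong₂ ℚ._+_ (ChS≈Ch n i j) (≡.cong ℚ.-_ (⊛-≈ qS≈q̂ ShS≈Sh n i j))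

  open CommutativeRing ℚ[[q,p,x]].commutativeRing using (_≈_; _*_; _-_; refl)
  open import Algebra.Properties.Ring (CommutativeRing.ring ℚ[[q,p,x]].commutativeRing) using (x∙y⁻¹≈ε⇒x≈y)
  open Solutions
  open FromDefs
  open OperatorL using (L)
  open OperatorL-coefficients using (L-coeff)
  open Constants using (∂x-coeff)
  open CoefficientsOfD using (b-suc; DCoeff; DCoeff-*ʳ)

  ∂x-B≈L̂-B : ∂x BS ≈ L̂ BS
  ∂x-B≈L̂-B n i j = begin
    ∂x BS n i j                                             ≡⟨ ∂x-coeff BS n i j ⟩
    ℕtoℚ (suc n) ℚ.* (b (suc n) i j ℚ.* inv! (suc n))       ≡⟨ ℚ.*-assoc (ℕtoℚ (suc n)) _ _ ⟨
    ℕtoℚ (suc n) ℚ.* b (suc n) i j ℚ.* inv! (suc n)         ≡⟨ ≡.cong (ℚ._* inv! (suc n)) (ℚ.*-comm (ℕtoℚ (suc n)) _) ⟩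
    b (suc n) i j ℚ.* ℕtoℚ (suc n) ℚ.* inv! (suc n)         ≡⟨ ℚ.*-assoc (b (suc n) i j) _ _ ⟩
    b (suc n) i j ℚ.* (ℕtoℚ (suc n) ℚ.* inv! (suc n))       ≡⟨ ≡.cong₂ ℚ._*_ (b-suc n i j) (ℕtoℚ-suc-*-inv!-suc n) ⟩
    DCoeff (b n) i j ℚ.* inv! n                             ≡⟨ DCoeff-*ʳ (b n) (inv! n) i j ⟨
    DCoeff (BS n) i j                                       ≡⟨ L-coeff (BS n) i j ⟨
    L (BS n) i j                                            ∎
    where open ≡.≡-Reasoning

  B*U≈p̂*exp : BS * U ≈ p̂ * exp
  B*U≈p̂*exp = x∙y⁻¹≈ε⇒x≈y (BS * U) (p̂ * exp) (solution-unique W W-isSolution W₀≈0)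
    where
    module R₂ = CommutativeRing ℚ[[q,p]].commutativeRing
    W = BS * U - p̂ * exp

    W-isSolution : IsSolution W
    W-isSolution = -‿isSolution (BS * U) (p̂ * exp) (*-U-isSolution BS ∂x-B≈L̂-B) p̂*exp-isSolution

    B₀≈p : BS 0 R₂.≈ p
    B₀≈p zero          j       = ≡.refl
    B₀≈p (suc zero)    zero    = ≡.refl
    B₀≈p (suc zero)    (suc j) = ≡.refl
    B₀≈p (suc (suc i)) j       = ≡.refl

    Ch₀≈1 : Ch 0 R₂.≈ R₂.1#
    Ch₀≈1 = R₂.trans (R₂.*-identityˡ (E 0 0)) (R₂.*-identityʳ (const₂ (inv! 0)))

    W₀≈0 : W 0 R₂.≈ R₂.0#
    W₀≈0 = R₂.trans (R₂.+-congʳ (R₂.*-cong B₀≈p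
                      (R₂.+-cong Ch₀≈1 (R₂.-‿cong (R₂.trans (R₂.*-congˡ {q} Sh₀≈0) (R₂.zeroʳ q))))))
                    (solve 1 (λ p → p :* (con (+ 1) :- con (+ 0)) :- p :* con (+ 1) := con (+ 0)) R₂.refl p)
      where
      open ℚ[[q,p]].SeriesRing using (solve; _:*_; _:-_; _:=_; con)
      open import Data.Integer using (+_)
      Sh₀≈0 : Sh 0 R₂.≈ R₂.0#
      Sh₀≈0 = Sh-term-vanishesBelow 0 0 (s≤s z≤n)

  B⊛[ChS⊖qS⊛ShS]≡pS⊛expS : (n i j : ℕ) → (BS ⊛ (ChS ⊖ (qS ⊛ ShS))) n i j ≡ (pS ⊛ expS) n i j
  B⊛[ChS⊖qS⊛ShS]≡pS⊛expS n i j =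
    ≡.trans (⊛-≈ {BS} refl ChS⊖qS⊛ShS≈U n i j) (≡.trans (B*U≈p̂*exp n i j) (≡.sym (⊛-≈ pS≈p̂ expS≈exp n i j)))

open import Defs using (BS; ChS; ShS; qS; pS; expS; _⊛_; _⊖_; b; S; P; ℕtoℚ)
open import Data.Nat using (ℕ; _≥_; _∸_; _+_; _*_)
open import Data.Product using (_×_; _,_)
open import Relation.Binary.PropositionalEquality using (_≡_)

theorem2 : ((n i j : ℕ) → (BS ⊛ (ChS ⊖ (qS ⊛ ShS))) n i j ≡ (pS ⊛ expS) n i j)
           × ((n i j : ℕ) → n ≥ 1 → i ≥ 1 → j ≥ 1 →
              b n (2 * i ∸ 1) j ≡ ℕtoℚ (S (n + 1) (2 * i ∸ 1 + j) * P (2 * i ∸ 2 + j) (i ∸ 1)))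
theorem2 = GeneratingFunction.B⊛[ChS⊖qS⊛ShS]≡pS⊛expS , OddCoefficients.b-odd≡S*P
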